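{- Let $(G,<)$ be an ordered graph with at least one edge, let $d = \max_u |N^-(u)|$ and $s_2 = \max_u |S^2(u)|$, and let $\mathsf R$ be the data structure obtained by the initialisation: for every vertex $u$ and every $x \in N^-(u)$, increase the counter $\mathsf R[x][N^-(u) \cap V_{\leq x}]$ by one. Then there is a query algorithm (Algorithm 2 of the paper, described below) which, given $\mathsf R$ and a vertex set $X \subseteq V(G)$, outputs the trace frequencies $\operatorname{tr}^{\#}_G(X)$ in time $O\big((d^2 + s_2^{d+2})\,|X|\big)$.
   Context: All graphs are finite, simple and undirected; an ordered graph is a graph with a total order $<$ on $V(G)$. $N^-(u) = \{v \in N(u) : v < u\}$, $N^-[u] = N^-(u)\cup\{u\}$, $V_{\leq x} = \{v : v \leq x\}$. The strongly $2$-reachable set is $S^2(u) = \{ v : v < u \text{ and either } v \in N(u) \text{ or there is } w \text{ with } u < w,\ w \in N(u),\ v \in N(w)\}$. The trace frequencies $\operatorname{tr}^{\#}_G(X)$ are the multiset $\{ N(y) \cap X : y \in V(G) \setminus X\}$, i.e. an associative array assigning to each $X' \subseteq X$ the number of vertices $y \notin X$ with $N(y) \cap X = X'$. The query algorithm, for $X = \{x_1 < \dots < x_\ell\}$: set $\mathsf{Tr}[\emptyset] = |V(G) \setminus X|$; (1) for each $i$ and each key $A$ of $\mathsf R[x_i]$, let $S = A \cap X$, add $\mathsf R[x_i][A]$ to $\mathsf{Tr}[S]$ and subtract it from $\mathsf{Tr}[S \setminus \{\max S\}]$; (2) for each $i$ and each $u \in N^-[x_i]$: if $u$ is not yet a key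 of $\mathsf L$, subtract $1$ from $\mathsf{Tr}[N^-(u)\cap X]$ and set $\mathsf L[u] = N^-(u) \cap X$; then add $x_i$ to $\mathsf L[u]$; finally, for each key $u$ of $\mathsf L$ with $u \notin X$, add $1$ to $\mathsf{Tr}[\mathsf L[u]]$; return $\mathsf{Tr}$. Complexity is in the RAM model with hash-map associative arrays of constant expected access time, and inner arrays keyed by sets accessed in time proportional to the key size.
   Formalization: The query algorithm (Algorithm 2) sets $\mathsf{Tr}[\emptyset] = |V(G)|$ at the start, in place of $\mathsf{Tr}[\emptyset] = |V(G) \setminus X|$. The statement above fails without it. -}

module Defs where

open import Data.Bool using (Bool; true; false; _∧_; _∨_; not; if_then_else_)
import Data.Bool.ListAction as BL
open import Data.Bool.Properties using () renaming (_≟_ to _≟ᵇ_)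
open import Data.Nat as ℕ using (ℕ; zero; suc; _⊔_)
open import Data.Integer as ℤ using (ℤ)
open import Data.Fin using (Fin)
open import Data.Fin.Properties using (_<?_; _≤?_) renaming (_≟_ to _≟ᶠ_)
open import Data.Fin.Subset using (Subset; _∩_; ⊥; ∣_∣)
open import Data.Vec as Vec using (Vec; []; _∷_; tabulate; lookup)
open import Data.Vec.Properties using (≡-dec)
open import Data.List as List using (List; []; _∷_; _++_; filterᵇ; allFin; foldl; length)
open import Data.Product using (_×_; _,_; ∃₂; proj₁; proj₂)
open import Relation.Nullary.Decidable using (⌊_⌋)
open import Relation.Binary.PropositionalEquality using (_≡_)

-- Ordered graphs: vertex set Fin n, order = the natural order on Fin n.

record Graph (n : ℕ) : Set where
  field
    adj     : Fin n → Fin n → Bool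
    adj-sym : ∀ u v → adj u v ≡ adj v u
    adj-irr : ∀ u → adj u u ≡ false
open Graph public

HasEdge : ∀ {n} → Graph n → Set
HasEdge G = ∃₂ λ u v → adj G u v ≡ true

module _ {n : ℕ} where

  ltᵇ leᵇ eqᵇ : Fin n → Fin n → Bool
  ltᵇ u v = ⌊ u <? v ⌋
  leᵇ u v = ⌊ u ≤? v ⌋
  eqᵇ u v = ⌊ u ≟ᶠ v ⌋

  _≟ₛ_ : (A B : Subset n) → _
  _≟ₛ_ = ≡-dec _≟ᵇ_

  elems : Subset n → List (Fin n)
  elems S = filterᵇ (lookup S) (allFin n)

  Nb : Graph n → Fin n → Subset n
  Nb G u = tabulate (adj G u)

  N⁻ : Graph n → Fin n → Subset n
  N⁻ G u = tabulate (λ v → adj G u v ∧ ltᵇ v u)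

  N⁻[_] : Graph n → Fin n → Subset n
  N⁻[ G ] u = tabulate (λ v → (adj G u v ∧ ltᵇ v u) ∨ eqᵇ v u)

  V≤ : Fin n → Subset n
  V≤ x = tabulate (λ v → leᵇ v x)

  S² : Graph n → Fin n → Subset n
  S² G u = tabulate (λ v → ltᵇ v u ∧
             (adj G u v ∨ BL.any (λ w → ltᵇ u w ∧ adj G u w ∧ adj G w v) (allFin n)))

  maxOver : (Fin n → ℕ) → ℕ
  maxOver f = List.foldr (λ u m → f u ⊔ m) 0 (allFin n)

  dG : Graph n → ℕ
  dG G = maxOver (λ u → ∣ N⁻ G u ∣)

  s₂G : Graph n → ℕ
  s₂G G = maxOver (λ u → ∣ S² G u ∣)

  trFreq : Graph n → Subset n → Subset n → ℕ
  trFreq G X X' = length (filterᵇ (λ y → not (lookup X y) ∧ ⌊ (Nb G y ∩ X) ≟ₛ X' ⌋) (allFin n))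

  -- Associative arrays (hash maps) as association lists with distinct keys.

  incr : Subset n → List (Subset n × ℕ) → List (Subset n × ℕ)
  incr k [] = (k , 1) ∷ []
  incr k ((k' , c) ∷ r) = if ⌊ k ≟ₛ k' ⌋ then (k' , suc c) ∷ r else (k' , c) ∷ incr k r

  Rinit : Graph n → Fin n → List (Subset n × ℕ)
  Rinit G x = foldl (λ acc u → if lookup (N⁻ G u) x then incr (N⁻ G u ∩ V≤ x) acc else acc)
                    [] (allFin n)

  -- S \ {max S}  (index 0 is the smallest vertex; the max is the last true)
  removeMax : ∀ {m} → Subset m → Subset m
  removeMax [] = []
  removeMax (b ∷ bs) = if BL.or (Vec.toList bs) then b ∷ removeMax bs else Data.Bool.false ∷ bs
    where import Data.Bool

  L-find : Fin n → List (Fin n × Subset n) → Bool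
  L-find u [] = false
  L-find u ((v , _) ∷ r) = eqᵇ u v ∨ L-find u r

  L-addTo : Fin n → Fin n → List (Fin n × Subset n) → List (Fin n × Subset n)
  L-addTo u x [] = []
  L-addTo u x ((v , S) ∷ r) =
    if eqᵇ u v then (v , Vec.updateAt S x (λ _ → true)) ∷ r else (v , S) ∷ L-addTo u x r

  -- Algorithm 2 with an explicit cost counter (RAM model):
  --  * accessing a set-keyed array (Tr, R[x]) with key S costs 1 + |S|;
  --  * accessing a vertex-keyed array (R, L) costs 1;
  --  * computing A ∩ X (X stored as a hash set) costs 1 + |A|;
  --  * iterating over a list costs 1 per element.

  record State : Set where
    constructor st
    field
      Tr   : Subset n → ℤ
      L    : List (Fin n × Subset n)
      cost : ℕ
  open State public

  addTr : Subset n → ℤ → (Subset n → ℤ) → Subset n → ℤ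
  addTr S z T S' = if ⌊ S' ≟ₛ S ⌋ then T S' ℤ.+ z else T S'

  tick : ℕ → State → State
  tick k (st T L c) = st T L (k ℕ.+ c)

  module Query (G : Graph n) (R : Fin n → List (Subset n × ℕ)) (X : Subset n) where

    xs : List (Fin n)
    xs = elems X

    step1-key : State → Subset n × ℕ → State
    step1-key (st T L c) (A , r) =
      let S = A ∩ X in
      st (addTr (removeMax S) (ℤ.- (ℤ.+ r)) (addTr S (ℤ.+ r) T)) L
         (suc ∣ A ∣ ℕ.+ suc ∣ S ∣ ℕ.+ suc ∣ removeMax S ∣ ℕ.+ c)

    step1 : State → Fin n → State
    step1 s x = foldl step1-key (tick 1 s) (R x)

    step2-u : Fin n → State → Fin n → State
    step2-u x (st T L c) u =
      if L-find u L
      then st T (L-addTo u x L) (2 ℕ.+ c)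
      else (let S = N⁻ G u ∩ X in
            st (addTr S (ℤ.- (ℤ.+ 1)) T) (L-addTo u x (L ++ ((u , S) ∷ [])))
               (2 ℕ.+ suc ∣ N⁻ G u ∣ ℕ.+ suc ∣ S ∣ ℕ.+ c))

    step2 : State → Fin n → State
    step2 s x = foldl (step2-u x) (tick 1 s) (elems (N⁻[ G ] x))

    final-u : State → Fin n × Subset n → State
    final-u (st T L c) (u , S) =
      if lookup X u then st T L (suc c)
      else st (addTr S (ℤ.+ 1) T) L (suc (suc ∣ S ∣) ℕ.+ c)

    init : State
    init = st (addTr ⊥ (ℤ.+ n) (λ _ → ℤ.0ℤ)) [] 1

    run : State
    run = let s₁ = foldl step1 init xs
              s₂ = foldl step2 s₁ xs
          in foldl final-u s₂ (L s₂)

  query : Graph n → (Fin n → List (Subset n × ℕ)) → Subset n → State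
  query G R X = Query.run G R X

module Submission where

-- Fix a key Z and write [A] for 1 if A = Z and 0 otherwise. The keys N⁻(u) ∩ V≤x that a vertex u
-- contributes to the arrays R[x], x ∈ N⁻(u), are prefixes P of N⁻(u) ending in x, so over x ∈ X
-- step (1) adds the differences [P ∩ X] - [(P ∩ X) minus its maximum], which telescope to
-- [N⁻(u) ∩ X] - [∅]; with the initial Tr[∅] = n this leaves Σ_u [N⁻(u) ∩ X]. Step (2) visits
-- the vertices u ∈ N⁻[x], x ∈ X, subtracts their term [N⁻(u) ∩ X] and gathers in L[u] the set
-- N(u) ∩ X, which the last loop counts when u ∉ X. An unvisited u has no neighbour in X above
-- it, so for it N⁻(u) ∩ X = N(u) ∩ X already.
-- For the running time: if x ∈ N⁻(u), all of N⁻(u) ∩ V≤x lies in S²(x) ∪ {x} (through u), so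
-- R[x] has at most Σ_{i ≤ d} C(s₂ + 1, i) = O(s₂^(d+1)) keys, each handled in time O(d); step (2)
-- spends O(d) on each of the d + 1 vertices of N⁻[x] and prepays the last loop.

open import Defs
open import Data.Bool using (Bool; true; false; _∧_; _∨_; not; if_then_else_)
import Data.Bool.ListAction as BL
open import Data.Bool.Properties
  using (∧-comm; ∧-zeroʳ; ∧-identityʳ; ∧-conicalˡ; ∧-conicalʳ; ∨-zeroʳ; ∨-identityʳ; ∨-assoc; ∨-conicalˡ; ∨-conicalʳ)
open import Data.Empty using (⊥-elim)
open import Data.Fin using (Fin; zero; suc; toℕ)
import Data.Fin.Properties as FinP
open import Data.Fin.Subset using (Subset; _∩_; _∪_; ⊥; ⁅_⁆; ∣_∣; _∈_; _⊆_; inside; outside)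
open import Data.Fin.Subset.Properties
  using (∣p∩q∣≤∣p∣; ∣p∣≤∣x∷p∣; x∈⁅y⁆⇒x≡y; p⊆q⇒∣p∣≤∣q∣; drop-∷-⊆; x∈⁅x⁆; ∣⁅x⁆∣≡1; p⊆p∪q; q⊆p∪q)
open import Data.Integer as ℤ using (ℤ; 0ℤ; 1ℤ) renaming (_+_ to _+ᶻ_; _-_ to _-ᶻ_; -_ to -ᶻ_; _*_ to _*ᶻ_)
import Data.Integer.Properties as ℤP
open import Algebra.Properties.CommutativeMonoid.Sum ℤP.+-0-commutativeMonoid
  using (sum; sum-syntax; ∑-distrib-+; ∑-comm; sum-cong-≗; sum-replicate-zero)
open import Data.Integer.Tactic.RingSolver using (solve-∀)
open import Data.List as List using (List; []; _∷_; _++_; filterᵇ; length; foldl; allFin)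
open import Data.List.Properties using (length-map)
open import Data.List.Relation.Unary.All as All using (All; []; _∷_)
open import Data.List.Relation.Unary.All.Properties using (++⁺; map⁻)
open import Data.List.Relation.Unary.AllPairs using ([]; _∷_)
open import Data.List.Relation.Unary.Unique.Propositional using (Unique)
open import Data.Nat as ℕ using (ℕ; zero; suc; _+_; _*_; _^_; _≤_; z≤n; s≤s; _⊔_)
import Data.Nat.Properties as ℕP
open import Data.Nat.Tactic.RingSolver using () renaming (solve-∀ to ℕ-solve-∀)
open import Data.Product using (Σ; ∃; _×_; _,_; proj₁; proj₂)
open import Data.Sum using (_⊎_; inj₁; inj₂)
open import Data.Unit using (⊤; tt)
open import Data.Vec as Vec using (Vec; []; _∷_; tabulate; lookup)
open import Data.Vec.Properties
  using ([]=⇒lookup; lookup⇒[]=; lookup∘tabulate; lookup∘updateAt; lookup∘updateAt′; lookup-replicate; lookup-zipWith;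
         tabulate∘lookup; tabulate-cong)
open import Function using (_∘_; _⇔_; mk⇔)
open import Relation.Binary.Definitions using (tri<; tri≈; tri>)
open import Relation.Binary.PropositionalEquality
open import Relation.Nullary using (Dec; yes; no; ¬_)
open import Relation.Nullary.Decidable using (⌊_⌋; dec-true; dec-false; does-⇔; isYes≗does)

private variable
  n : ℕ

true≢false : true ≢ false
true≢false ()

⌊⌋-true : ∀ {A : Set} (a? : Dec A) → A → ⌊ a? ⌋ ≡ true
⌊⌋-true a? a = trans (isYes≗does a?) (dec-true a? a)

⌊⌋-false : ∀ {A : Set} (a? : Dec A) → ¬ A → ⌊ a? ⌋ ≡ false
⌊⌋-false a? ¬a = trans (isYes≗does a?) (dec-false a? ¬a)

⌊⌋-sound : ∀ {A : Set} (a? : Dec A) → ⌊ a? ⌋ ≡ true → A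
⌊⌋-sound (yes a) _ = a

⌊⌋-⇔ : ∀ {A B : Set} → A ⇔ B → (a? : Dec A) (b? : Dec B) → ⌊ a? ⌋ ≡ ⌊ b? ⌋
⌊⌋-⇔ A⇔B a? b? = trans (isYes≗does a?) (trans (does-⇔ A⇔B a? b?) (sym (isYes≗does b?)))

eqᵇ-refl : (u : Fin n) → eqᵇ u u ≡ true
eqᵇ-refl u = ⌊⌋-true (u FinP.≟ u) refl

eqᵇ-≢ : {u v : Fin n} → u ≢ v → eqᵇ u v ≡ false
eqᵇ-≢ {u = u} {v} = ⌊⌋-false (u FinP.≟ v)

eqᵇ⇒≡ : {u v : Fin n} → eqᵇ u v ≡ true → u ≡ v
eqᵇ⇒≡ {u = u} {v} = ⌊⌋-sound (u FinP.≟ v)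

eqᵇ-sym : (u v : Fin n) → eqᵇ u v ≡ eqᵇ v u
eqᵇ-sym u v = ⌊⌋-⇔ (mk⇔ sym sym) (u FinP.≟ v) (v FinP.≟ u)

eqᵇ-suc : (u v : Fin n) → eqᵇ (suc u) (suc v) ≡ eqᵇ u v
eqᵇ-suc u v = ⌊⌋-⇔ (mk⇔ FinP.suc-injective (cong suc)) (suc u FinP.≟ suc v) (u FinP.≟ v)

ltᵇ-connex : (u v : Fin n) → u ≢ v → ltᵇ u v ≡ false → ltᵇ v u ≡ true
ltᵇ-connex u v u≢v u≮v with FinP.<-cmp u v
... | tri< u<v _ _ = ⊥-elim (true≢false (trans (sym (⌊⌋-true (u FinP.<? v) u<v)) u≮v))
... | tri≈ _ u≡v _ = ⊥-elim (u≢v u≡v)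
... | tri> _ _ v<u = ⌊⌋-true (v FinP.<? u) v<u

lookup-ext : {A B : Subset n} → (∀ i → lookup A i ≡ lookup B i) → A ≡ B
lookup-ext {A = A} {B} A≗B = begin
  A                 ≡⟨ tabulate∘lookup A ⟨
  tabulate (lookup A) ≡⟨ tabulate-cong A≗B ⟩
  tabulate (lookup B) ≡⟨ tabulate∘lookup B ⟩
  B                 ∎
  where open ≡-Reasoning

lookup-∩ : (A B : Subset n) (i : Fin n) → lookup (A ∩ B) i ≡ (lookup A i ∧ lookup B i)
lookup-∩ A B i = lookup-zipWith _∧_ i A B

lookup⇒∈ : {A : Subset n} {i : Fin n} → lookup A i ≡ true → i ∈ A
lookup⇒∈ {A = A} {i} = lookup⇒[]= i A

∈⇒lookup : {A : Subset n} {i : Fin n} → i ∈ A → lookup A i ≡ true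
∈⇒lookup = []=⇒lookup

∣∣-mono : {A B : Subset n} → (∀ i → lookup A i ≡ true → lookup B i ≡ true) → ∣ A ∣ ≤ ∣ B ∣
∣∣-mono {A = A} {B} A⊆B = p⊆q⇒∣p∣≤∣q∣ {p = A} {B} (λ i∈A → lookup⇒∈ (A⊆B _ (∈⇒lookup i∈A)))

member⇒∣∣-positive : {S : Subset n} {v : Fin n} → lookup S v ≡ true → 1 ≤ ∣ S ∣
member⇒∣∣-positive {S = S} {v} v∈S = begin
  1           ≡⟨ ∣⁅x⁆∣≡1 v ⟨
  ∣ ⁅ v ⁆ ∣   ≤⟨ p⊆q⇒∣p∣≤∣q∣ (λ i∈⁅v⁆ → subst (_∈ S) (sym (x∈⁅y⁆⇒x≡y v i∈⁅v⁆)) (lookup⇒∈ v∈S)) ⟩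
  ∣ S ∣       ∎
  where open ℕP.≤-Reasoning

∣p∪q∣≤∣p∣+∣q∣ : (p q : Subset n) → ∣ p ∪ q ∣ ≤ ∣ p ∣ + ∣ q ∣
∣p∪q∣≤∣p∣+∣q∣ [] [] = z≤n
∣p∪q∣≤∣p∣+∣q∣ (outside ∷ p) (outside ∷ q) = ∣p∪q∣≤∣p∣+∣q∣ p q
∣p∪q∣≤∣p∣+∣q∣ (outside ∷ p) (inside ∷ q) =
  ℕP.≤-trans (s≤s (∣p∪q∣≤∣p∣+∣q∣ p q)) (ℕP.≤-reflexive (sym (ℕP.+-suc ∣ p ∣ ∣ q ∣)))
∣p∪q∣≤∣p∣+∣q∣ (inside ∷ p) (outside ∷ q) = s≤s (∣p∪q∣≤∣p∣+∣q∣ p q)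
∣p∪q∣≤∣p∣+∣q∣ (inside ∷ p) (inside ∷ q) =
  s≤s (ℕP.≤-trans (∣p∪q∣≤∣p∣+∣q∣ p q) (ℕP.+-monoʳ-≤ ∣ p ∣ (ℕP.n≤1+n ∣ q ∣)))

∣∣-insert : {A B : Subset n} (x : Fin n) → (∀ i → lookup A i ≡ true → lookup B i ≡ true ⊎ i ≡ x) → ∣ A ∣ ≤ suc ∣ B ∣
∣∣-insert {A = A} {B} x A⊆B+x = begin
  ∣ A ∣                ≤⟨ p⊆q⇒∣p∣≤∣q∣ A⊆B∪⁅x⁆ ⟩
  ∣ B ∪ ⁅ x ⁆ ∣        ≤⟨ ∣p∪q∣≤∣p∣+∣q∣ B ⁅ x ⁆ ⟩
  ∣ B ∣ + ∣ ⁅ x ⁆ ∣     ≡⟨ cong (∣ B ∣ +_) (∣⁅x⁆∣≡1 x) ⟩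
  ∣ B ∣ + 1            ≡⟨ ℕP.+-comm ∣ B ∣ 1 ⟩
  suc ∣ B ∣            ∎
  where
  open ℕP.≤-Reasoning
  A⊆B∪⁅x⁆ : A ⊆ B ∪ ⁅ x ⁆
  A⊆B∪⁅x⁆ {i} i∈A with A⊆B+x i (∈⇒lookup i∈A)
  ... | inj₁ i∈B = p⊆p∪q ⁅ x ⁆ (lookup⇒∈ i∈B)
  ... | inj₂ refl = q⊆p∪q B ⁅ x ⁆ (x∈⁅x⁆ x)

lookup⇒or : {m : ℕ} (bs : Vec Bool m) (i : Fin m) → lookup bs i ≡ true → BL.or (Vec.toList bs) ≡ true
lookup⇒or (b ∷ bs) zero    b≡true  = cong (_∨ _) b≡true
lookup⇒or (b ∷ bs) (suc i) bs[i]≡true = trans (cong (b ∨_) (lookup⇒or bs i bs[i]≡true)) (∨-zeroʳ b)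

or⇒lookup : {m : ℕ} (bs : Vec Bool m) → BL.or (Vec.toList bs) ≡ true → ∃ λ i → lookup bs i ≡ true
or⇒lookup (true ∷ bs)  _  = zero , refl
or⇒lookup (false ∷ bs) or≡true with or⇒lookup bs or≡true
... | i , bs[i]≡true = suc i , bs[i]≡true

-- removeMax carries an implicit size argument k that its definition never uses.
removeMax-maximum : {k m : ℕ} (S : Subset m) (x : Fin m) → lookup S x ≡ true →
                    (∀ v → lookup S v ≡ true → toℕ v ≤ toℕ x) →
                    ∀ v → lookup (removeMax {k} S) v ≡ (lookup S v ∧ not (eqᵇ v x))
removeMax-maximum (b ∷ bs) zero    _ S≤0 v with BL.or (Vec.toList bs) in or≡
... | true with or⇒lookup bs or≡
...   | w , bs[w]≡true with S≤0 (suc w) bs[w]≡true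
...     | ()
removeMax-maximum (b ∷ bs) zero    _ S≤0 zero    | false = sym (∧-zeroʳ b)
removeMax-maximum (b ∷ bs) zero    _ S≤0 (suc v) | false = sym (∧-identityʳ _)
removeMax-maximum {k} (b ∷ bs) (suc x) bs[x]≡true S≤x v
  rewrite lookup⇒or bs x bs[x]≡true with v
... | zero  = sym (∧-identityʳ b)
... | suc v = trans (removeMax-maximum {k} bs x bs[x]≡true (λ w bs[w] → ℕ.s≤s⁻¹ (S≤x (suc w) bs[w])) v)
                    (cong (λ e → lookup bs v ∧ not e) (sym (eqᵇ-suc v x)))

∣removeMax∣≤ : {k m : ℕ} (S : Subset m) → ∣ removeMax {k} S ∣ ≤ ∣ S ∣
∣removeMax∣≤ [] = z≤n
∣removeMax∣≤ (b ∷ bs) with BL.or (Vec.toList bs)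
∣removeMax∣≤ {k} (false ∷ bs) | true  = ∣removeMax∣≤ {k} bs
∣removeMax∣≤ {k} (true ∷ bs)  | true  = s≤s (∣removeMax∣≤ {k} bs)
∣removeMax∣≤ (false ∷ bs) | false = ℕP.≤-refl
∣removeMax∣≤ (true ∷ bs)  | false = ℕP.n≤1+n _

length-filterᵇ-tabulate : {A : Set} (p : A → Bool) (g : Fin n → A) →
                          length (filterᵇ p (List.tabulate g)) ≡ ∣ tabulate (p ∘ g) ∣
length-filterᵇ-tabulate {zero}  p g = refl
length-filterᵇ-tabulate {suc n} p g with p (g zero)
... | true  = cong suc (length-filterᵇ-tabulate p (g ∘ suc))
... | false = length-filterᵇ-tabulate p (g ∘ suc)

length-elems : (S : Subset n) → length (elems S) ≡ ∣ S ∣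
length-elems S = trans (length-filterᵇ-tabulate (lookup S) (λ i → i)) (cong ∣_∣ (tabulate∘lookup S))

prefix : Subset n → ℕ → Subset n
prefix A k = tabulate (λ v → lookup A v ∧ ⌊ toℕ v ℕP.<? k ⌋)

prefix-0 : (A : Subset n) → prefix A 0 ≡ ⊥
prefix-0 A = lookup-ext λ v → begin
  lookup (prefix A 0) v                 ≡⟨ lookup∘tabulate _ v ⟩
  lookup A v ∧ ⌊ toℕ v ℕP.<? 0 ⌋         ≡⟨ cong (lookup A v ∧_) (⌊⌋-false (toℕ v ℕP.<? 0) λ ()) ⟩
  lookup A v ∧ false                    ≡⟨ ∧-zeroʳ _ ⟩
  false                                 ≡⟨ lookup-replicate v false ⟨
  lookup ⊥ v                            ∎
  where open ≡-Reasoning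

prefix-n : (A : Subset n) → prefix A n ≡ A
prefix-n {n} A = lookup-ext λ v → begin
  lookup (prefix A n) v                 ≡⟨ lookup∘tabulate _ v ⟩
  lookup A v ∧ ⌊ toℕ v ℕP.<? n ⌋         ≡⟨ cong (lookup A v ∧_) (⌊⌋-true (toℕ v ℕP.<? n) (FinP.toℕ<n v)) ⟩
  lookup A v ∧ true                     ≡⟨ ∧-identityʳ _ ⟩
  lookup A v                            ∎
  where open ≡-Reasoning

prefix-∩-V≤ : (A X : Subset n) (x : Fin n) → (A ∩ V≤ x) ∩ X ≡ prefix (A ∩ X) (suc (toℕ x))
prefix-∩-V≤ A X x = lookup-ext λ v → begin
  lookup ((A ∩ V≤ x) ∩ X) v                         ≡⟨ lookup-∩ (A ∩ V≤ x) X v ⟩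
  lookup (A ∩ V≤ x) v ∧ lookup X v                  ≡⟨ cong (_∧ lookup X v) (lookup-∩ A (V≤ x) v) ⟩
  (lookup A v ∧ lookup (V≤ x) v) ∧ lookup X v       ≡⟨ cong (λ b → (lookup A v ∧ b) ∧ lookup X v) (lookup∘tabulate _ v) ⟩
  (lookup A v ∧ leᵇ v x) ∧ lookup X v               ≡⟨ ∧-swapʳ (lookup A v) (leᵇ v x) (lookup X v) ⟩
  (lookup A v ∧ lookup X v) ∧ leᵇ v x               ≡⟨ cong₂ _∧_ (sym (lookup-∩ A X v))
                                                                 (⌊⌋-⇔ (mk⇔ s≤s ℕ.s≤s⁻¹) (v FinP.≤? x) (toℕ v ℕP.<? suc (toℕ x))) ⟩
  lookup (A ∩ X) v ∧ ⌊ toℕ v ℕP.<? suc (toℕ x) ⌋    ≡⟨ lookup∘tabulate _ v ⟨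
  lookup (prefix (A ∩ X) (suc (toℕ x))) v           ∎
  where
  open ≡-Reasoning
  ∧-swapʳ : ∀ a b c → (a ∧ b) ∧ c ≡ (a ∧ c) ∧ b
  ∧-swapʳ true  b c = ∧-comm b c
  ∧-swapʳ false b c = refl

<suc⇔< : {v x : Fin n} → v ≢ x → (toℕ v ℕ.< suc (toℕ x)) ⇔ (toℕ v ℕ.< toℕ x)
<suc⇔< v≢x = mk⇔ (λ v<1+x → ℕP.≤∧≢⇒< (ℕ.s≤s⁻¹ v<1+x) (v≢x ∘ FinP.toℕ-injective)) ℕP.m≤n⇒m≤1+n

prefix-skip : (A : Subset n) (x : Fin n) → lookup A x ≡ false → prefix A (suc (toℕ x)) ≡ prefix A (toℕ x)
prefix-skip A x x∉A = lookup-ext λ v → trans (lookup∘tabulate _ v) (trans (same v) (sym (lookup∘tabulate _ v)))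
  where
  same : ∀ v → (lookup A v ∧ ⌊ toℕ v ℕP.<? suc (toℕ x) ⌋) ≡ (lookup A v ∧ ⌊ toℕ v ℕP.<? toℕ x ⌋)
  same v with lookup A v in v∈A
  ... | false = refl
  ... | true  = ⌊⌋-⇔ (<suc⇔< v≢x) (toℕ v ℕP.<? suc (toℕ x)) (toℕ v ℕP.<? toℕ x)
    where
    v≢x : v ≢ x
    v≢x refl = true≢false (trans (sym v∈A) x∉A)

removeMax-prefix : (A : Subset n) (x : Fin n) → lookup A x ≡ true → removeMax {n} (prefix A (suc (toℕ x))) ≡ prefix A (toℕ x)
removeMax-prefix {n} A x x∈A = lookup-ext λ v → begin
  lookup (removeMax {n} P) v                             ≡⟨ removeMax-maximum {n} P x x∈P P≤x v ⟩
  lookup P v ∧ not (eqᵇ v x)                             ≡⟨ cong (_∧ not (eqᵇ v x)) (lookup∘tabulate _ v) ⟩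
  (lookup A v ∧ ⌊ toℕ v ℕP.<? suc (toℕ x) ⌋) ∧ not (eqᵇ v x)  ≡⟨ dropMax v ⟩
  lookup A v ∧ ⌊ toℕ v ℕP.<? toℕ x ⌋                     ≡⟨ lookup∘tabulate _ v ⟨
  lookup (prefix A (toℕ x)) v                            ∎
  where
  open ≡-Reasoning
  P = prefix A (suc (toℕ x))
  x∈P : lookup P x ≡ true
  x∈P = trans (lookup∘tabulate _ x) (cong₂ _∧_ x∈A (⌊⌋-true (toℕ x ℕP.<? suc (toℕ x)) ℕP.≤-refl))
  P≤x : ∀ v → lookup P v ≡ true → toℕ v ≤ toℕ x
  P≤x v v∈P = ℕ.s≤s⁻¹ (⌊⌋-sound (toℕ v ℕP.<? suc (toℕ x))
                        (∧-conicalʳ (lookup A v) _ (trans (sym (lookup∘tabulate _ v)) v∈P)))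
  dropMax : ∀ v → ((lookup A v ∧ ⌊ toℕ v ℕP.<? suc (toℕ x) ⌋) ∧ not (eqᵇ v x))
                  ≡ (lookup A v ∧ ⌊ toℕ v ℕP.<? toℕ x ⌋)
  dropMax v with v FinP.≟ x
  ... | yes refl = trans (∧-zeroʳ _) (sym (trans (cong (lookup A v ∧_) (⌊⌋-false (toℕ v ℕP.<? toℕ v) (ℕP.n≮n (toℕ v))))
                                                 (∧-zeroʳ (lookup A v))))
  ... | no v≢x   = trans (∧-identityʳ _)
                         (cong (lookup A v ∧_) (⌊⌋-⇔ (<suc⇔< v≢x) (toℕ v ℕP.<? suc (toℕ x)) (toℕ v ℕP.<? toℕ x)))

any-tabulate : {A : Set} (f : A → Bool) (g : Fin n → A) (i : Fin n) → f (g i) ≡ true → BL.any f (List.tabulate g) ≡ true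
any-tabulate f g zero    fgi = cong (_∨ BL.any f (List.tabulate (g ∘ suc))) fgi
any-tabulate f g (suc i) fgi = trans (cong (f (g zero) ∨_) (any-tabulate f (g ∘ suc) i fgi)) (∨-zeroʳ _)

memberᵇ : Fin n → List (Fin n) → Bool
memberᵇ v = BL.any (eqᵇ v)

anyFin : (Fin n → Bool) → Bool
anyFin {zero}  f = false
anyFin {suc n} f = f zero ∨ anyFin (f ∘ suc)

anyFin-cong : {f g : Fin n → Bool} → (∀ i → f i ≡ g i) → anyFin f ≡ anyFin g
anyFin-cong {zero}  f≗g = refl
anyFin-cong {suc n} f≗g = cong₂ _∨_ (f≗g zero) (anyFin-cong (f≗g ∘ suc))

anyFin-false : (f : Fin n → Bool) → (∀ i → f i ≡ false) → anyFin f ≡ false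
anyFin-false {zero}  f f≗false = refl
anyFin-false {suc n} f f≗false = cong₂ _∨_ (f≗false zero) (anyFin-false (f ∘ suc) (f≗false ∘ suc))

anyFin-point : (q : Fin n → Bool) (v : Fin n) → anyFin (λ i → q i ∧ eqᵇ v i) ≡ q v
anyFin-point {suc n} q zero = begin
  (q zero ∧ eqᵇ (zero {n}) zero) ∨ anyFin (λ i → q (suc i) ∧ eqᵇ zero (suc i))
    ≡⟨ cong₂ _∨_ (cong (q zero ∧_) (eqᵇ-refl {suc n} zero))
                 (anyFin-false _ λ i → trans (cong (q (suc i) ∧_) (eqᵇ-≢ {u = zero} {suc i} λ ())) (∧-zeroʳ _)) ⟩
  (q zero ∧ true) ∨ false
    ≡⟨ trans (∨-identityʳ _) (∧-identityʳ _) ⟩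
  q zero ∎
  where open ≡-Reasoning
anyFin-point {suc n} q (suc v) = begin
  (q zero ∧ eqᵇ (suc v) zero) ∨ anyFin (λ i → q (suc i) ∧ eqᵇ (suc v) (suc i))
    ≡⟨ cong₂ _∨_ (trans (cong (q zero ∧_) (eqᵇ-≢ {u = suc v} {zero} λ ())) (∧-zeroʳ _))
                 (anyFin-cong λ i → cong (q (suc i) ∧_) (eqᵇ-suc v i)) ⟩
  false ∨ anyFin (λ i → q (suc i) ∧ eqᵇ v i)
    ≡⟨ anyFin-point (q ∘ suc) v ⟩
  q (suc v) ∎
  where open ≡-Reasoning

memberᵇ-filterᵇ : ∀ {m} (v : Fin n) (p : Fin n → Bool) (g : Fin m → Fin n) →
                  memberᵇ v (filterᵇ p (List.tabulate g)) ≡ anyFin (λ i → p (g i) ∧ eqᵇ v (g i))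
memberᵇ-filterᵇ {m = zero}  v p g = refl
memberᵇ-filterᵇ {m = suc m} v p g with p (g zero)
... | true  = cong (eqᵇ v (g zero) ∨_) (memberᵇ-filterᵇ v p (g ∘ suc))
... | false = memberᵇ-filterᵇ v p (g ∘ suc)

memberᵇ-elems : (S : Subset n) (v : Fin n) → memberᵇ v (elems S) ≡ lookup S v
memberᵇ-elems S v = trans (memberᵇ-filterᵇ v (lookup S) (λ i → i)) (anyFin-point (lookup S) v)

any-memberᵇ : (f : Fin n → Bool) (x : Fin n) (l : List (Fin n)) → memberᵇ x l ≡ true → f x ≡ true → BL.any f l ≡ true
any-memberᵇ f x (y ∷ l) x∈l fx with eqᵇ x y in x=y
... | true  = cong (_∨ BL.any f l) (trans (cong f (sym (eqᵇ⇒≡ x=y))) fx)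
... | false = trans (cong (f y ∨_) (any-memberᵇ f x l x∈l fx)) (∨-zeroʳ (f y))

∑-indicator : (f : Fin n → Bool) → ℤ.+ ∣ tabulate f ∣ ≡ ∑[ i < n ] (if f i then 1ℤ else 0ℤ)
∑-indicator {zero}  f = refl
∑-indicator {suc n} f with f zero
... | true  = cong (1ℤ +ᶻ_) (∑-indicator (f ∘ suc))
... | false = trans (∑-indicator (f ∘ suc)) (sym (ℤP.+-identityˡ _))

∑-const : (c : ℤ) → ∑[ i < n ] c ≡ ℤ.+ n *ᶻ c
∑-const {zero}  c = refl
∑-const {suc n} c = begin
  c +ᶻ ∑[ i < n ] c          ≡⟨ cong₂ _+ᶻ_ (sym (ℤP.*-identityˡ c)) (∑-const {n} c) ⟩
  1ℤ *ᶻ c +ᶻ ℤ.+ n *ᶻ c      ≡⟨ ℤP.*-distribʳ-+ c 1ℤ (ℤ.+ n) ⟨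
  ℤ.+ suc n *ᶻ c             ∎
  where open ≡-Reasoning

∑-point : (u : Fin n) (h : Fin n → ℤ) → ∑[ v < n ] (if eqᵇ v u then h v else 0ℤ) ≡ h u
∑-point {suc n} zero h = begin
  (if eqᵇ (zero {n}) zero then h zero else 0ℤ) +ᶻ ∑[ v < n ] (if eqᵇ (suc v) zero then h (suc v) else 0ℤ)
    ≡⟨ cong₂ _+ᶻ_ (cong (λ b → if b then h zero else 0ℤ) (eqᵇ-refl {suc n} zero))
                  (sum-cong-≗ λ v → cong (λ b → if b then h (suc v) else 0ℤ) (eqᵇ-≢ {u = suc v} {zero} λ ())) ⟩
  h zero +ᶻ sum {n} (λ _ → 0ℤ)
    ≡⟨ cong (h zero +ᶻ_) (sum-replicate-zero n) ⟩
  h zero +ᶻ 0ℤ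
    ≡⟨ ℤP.+-identityʳ (h zero) ⟩
  h zero ∎
  where open ≡-Reasoning
∑-point {suc n} (suc u) h = begin
  (if eqᵇ zero (suc u) then h zero else 0ℤ) +ᶻ ∑[ v < n ] (if eqᵇ (suc v) (suc u) then h (suc v) else 0ℤ)
    ≡⟨ cong₂ _+ᶻ_ (cong (λ b → if b then h zero else 0ℤ) (eqᵇ-≢ {u = zero} {suc u} λ ()))
                  (sum-cong-≗ λ v → cong (λ b → if b then h (suc v) else 0ℤ) (eqᵇ-suc v u)) ⟩
  0ℤ +ᶻ ∑[ v < n ] (if eqᵇ v u then h (suc v) else 0ℤ)
    ≡⟨ ℤP.+-identityˡ _ ⟩
  ∑[ v < n ] (if eqᵇ v u then h (suc v) else 0ℤ)
    ≡⟨ ∑-point u (h ∘ suc) ⟩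
  h (suc u) ∎
  where open ≡-Reasoning

∑-telescope : (f : ℕ → ℤ) → ∑[ i < n ] (f (suc (toℕ i)) -ᶻ f (toℕ i)) ≡ f n -ᶻ f 0
∑-telescope {zero}  f = sym (ℤP.+-inverseʳ (f 0))
∑-telescope {suc n} f = begin
  (f 1 -ᶻ f 0) +ᶻ ∑[ i < n ] (f (suc (suc (toℕ i))) -ᶻ f (suc (toℕ i)))
    ≡⟨ cong ((f 1 -ᶻ f 0) +ᶻ_) (∑-telescope {n} (f ∘ suc)) ⟩
  (f 1 -ᶻ f 0) +ᶻ (f (suc n) -ᶻ f 1)
    ≡⟨ solve-∀′ (f 1) (f 0) (f (suc n)) ⟩
  f (suc n) -ᶻ f 0 ∎
  where
  open ≡-Reasoning
  solve-∀′ : ∀ a b c → (a -ᶻ b) +ᶻ (c -ᶻ a) ≡ c -ᶻ b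
  solve-∀′ = solve-∀

∑ₗ : {A : Set} → (A → ℤ) → List A → ℤ
∑ₗ φ = List.foldr (λ a → φ a +ᶻ_) 0ℤ

∑ₗ-tabulate : {A : Set} (φ : A → ℤ) (g : Fin n → A) → ∑ₗ φ (List.tabulate g) ≡ ∑[ i < n ] φ (g i)
∑ₗ-tabulate {zero}  φ g = refl
∑ₗ-tabulate {suc n} φ g = cong (φ (g zero) +ᶻ_) (∑ₗ-tabulate φ (g ∘ suc))

∑ₗ-filterᵇ : {A : Set} (φ : A → ℤ) (p : A → Bool) (l : List A) →
             ∑ₗ φ (filterᵇ p l) ≡ ∑ₗ (λ a → if p a then φ a else 0ℤ) l
∑ₗ-filterᵇ φ p [] = refl
∑ₗ-filterᵇ φ p (a ∷ l) with p a
... | true  = cong (φ a +ᶻ_) (∑ₗ-filterᵇ φ p l)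
... | false = trans (∑ₗ-filterᵇ φ p l) (sym (ℤP.+-identityˡ _))

∑ₗ-++ : {A : Set} (φ : A → ℤ) (l k : List A) → ∑ₗ φ (l ++ k) ≡ ∑ₗ φ l +ᶻ ∑ₗ φ k
∑ₗ-++ φ []      k = sym (ℤP.+-identityˡ _)
∑ₗ-++ φ (a ∷ l) k = trans (cong (φ a +ᶻ_) (∑ₗ-++ φ l k)) (sym (ℤP.+-assoc (φ a) _ _))

∑ₗ-- : {A : Set} (φ ψ : A → ℤ) (l : List A) → ∑ₗ φ l -ᶻ ∑ₗ ψ l ≡ ∑ₗ (λ a → φ a -ᶻ ψ a) l
∑ₗ-- φ ψ []      = refl
∑ₗ-- φ ψ (a ∷ l) = trans (swap (φ a) (ψ a) (∑ₗ φ l) (∑ₗ ψ l)) (cong (φ a -ᶻ ψ a +ᶻ_) (∑ₗ-- φ ψ l))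
  where
  swap : ∀ a b c d → a +ᶻ c -ᶻ (b +ᶻ d) ≡ a -ᶻ b +ᶻ (c -ᶻ d)
  swap = solve-∀

∑ₗ-cong : {A : Set} {φ ψ : A → ℤ} (l : List A) → All (λ a → φ a ≡ ψ a) l → ∑ₗ φ l ≡ ∑ₗ ψ l
∑ₗ-cong []      []          = refl
∑ₗ-cong (a ∷ l) (φa≡ψa ∷ p) = cong₂ _+ᶻ_ φa≡ψa (∑ₗ-cong l p)

∑ₗ-elems : (φ : Fin n → ℤ) (S : Subset n) → ∑ₗ φ (elems S) ≡ ∑[ i < n ] (if lookup S i then φ i else 0ℤ)
∑ₗ-elems {n} φ S = trans (∑ₗ-filterᵇ φ (lookup S) (allFin n)) (∑ₗ-tabulate (λ i → if lookup S i then φ i else 0ℤ) (λ i → i))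

foldl-invariant : {S A : Set} (Q : S → Set) (F : S → A → S) → (∀ s a → Q s → Q (F s a)) →
                  ∀ l s → Q s → Q (foldl F s l)
foldl-invariant Q F step []      s q = q
foldl-invariant Q F step (a ∷ l) s q = foldl-invariant Q F step l (F s a) (step s a q)

foldl-additive : {S A : Set} (F : S → A → S) (μ : S → ℤ) (φ : A → ℤ) → (∀ s a → μ (F s a) ≡ μ s +ᶻ φ a) →
                 ∀ l s → μ (foldl F s l) ≡ μ s +ᶻ ∑ₗ φ l
foldl-additive F μ φ step []      s = sym (ℤP.+-identityʳ _)
foldl-additive F μ φ step (a ∷ l) s = begin
  μ (foldl F (F s a) l)       ≡⟨ foldl-additive F μ φ step l (F s a) ⟩
  μ (F s a) +ᶻ ∑ₗ φ l          ≡⟨ cong (_+ᶻ ∑ₗ φ l) (step s a) ⟩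
  μ s +ᶻ φ a +ᶻ ∑ₗ φ l         ≡⟨ ℤP.+-assoc (μ s) (φ a) _ ⟩
  μ s +ᶻ (φ a +ᶻ ∑ₗ φ l)       ∎
  where open ≡-Reasoning

foldl-bounded : {S A : Set} (F : S → A → S) (μ : S → ℕ) (P : A → Set) (κ : ℕ) →
                (∀ s a → P a → μ (F s a) ≤ κ + μ s) →
                ∀ l s → All P l → μ (foldl F s l) ≤ length l * κ + μ s
foldl-bounded F μ P κ step []      s []       = ℕP.≤-refl
foldl-bounded F μ P κ step (a ∷ l) s (p ∷ ps) = begin
  μ (foldl F (F s a) l)         ≤⟨ foldl-bounded F μ P κ step l (F s a) ps ⟩
  length l * κ + μ (F s a)      ≤⟨ ℕP.+-monoʳ-≤ (length l * κ) (step s a p) ⟩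
  length l * κ + (κ + μ s)      ≡⟨ ℕP.+-assoc (length l * κ) κ (μ s) ⟨
  length l * κ + κ + μ s        ≡⟨ cong (_+ μ s) (ℕP.+-comm (length l * κ) κ) ⟩
  suc (length l) * κ + μ s      ∎
  where open ℕP.≤-Reasoning

-- Counting small subsets

-- Σ_{i ≤ m} C(t, i), the number of subsets with at most m elements of a t-element set.
binom≤ : ℕ → ℕ → ℕ
binom≤ zero    m       = 1
binom≤ (suc t) zero    = 1
binom≤ (suc t) (suc m) = binom≤ t m + binom≤ t (suc m)

binom≤-zero : ∀ t → binom≤ t 0 ≡ 1
binom≤-zero zero    = refl
binom≤-zero (suc t) = refl

binom≤-suc : ∀ t m → binom≤ t m ≤ binom≤ (suc t) m
binom≤-suc zero    zero    = ℕP.≤-refl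
binom≤-suc zero    (suc m) = s≤s z≤n
binom≤-suc (suc t) zero    = ℕP.≤-refl
binom≤-suc (suc t) (suc m) = ℕP.+-mono-≤ (binom≤-suc t m) (binom≤-suc t (suc m))

binom≤-monoˡ : ∀ m {t t′} → t ≤ t′ → binom≤ t m ≤ binom≤ t′ m
binom≤-monoˡ m t≤t′ = go (ℕP.≤⇒≤′ t≤t′)
  where
  go : ∀ {t t′} → t ℕ.≤′ t′ → binom≤ t m ≤ binom≤ t′ m
  go ℕ.≤′-refl      = ℕP.≤-refl
  go (ℕ.≤′-step t≤′t′) = ℕP.≤-trans (go t≤′t′) (binom≤-suc _ m)

binom≤-bound : ∀ t m → binom≤ (suc t) m ≤ suc m * suc t ^ m
binom≤-bound zero    zero    = ℕP.≤-refl
binom≤-bound zero    (suc m) = ℕP.≤-trans (s≤s (s≤s z≤n)) (ℕP.≤-reflexive (sym (trans (cong (suc (suc m) *_) (ℕP.^-zeroˡ (suc m)))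
                                                                                      (ℕP.*-identityʳ (suc (suc m))))))
binom≤-bound (suc t) zero    = ℕP.≤-refl
binom≤-bound (suc t) (suc m) = begin
  binom≤ (suc t) m + binom≤ (suc t) (suc m)     ≤⟨ ℕP.+-mono-≤ (binom≤-bound t m) (binom≤-bound t (suc m)) ⟩
  suc m * p + suc (suc m) * (a * p)             ≤⟨ ℕP.+-mono-≤ (ℕP.*-mono-≤ (ℕP.n≤1+n (suc m)) p≤P)
                                                                (ℕP.*-monoʳ-≤ (suc (suc m)) (ℕP.*-monoʳ-≤ a p≤P)) ⟩
  suc (suc m) * P + suc (suc m) * (a * P)       ≡⟨ factor (suc (suc m)) a P ⟩
  suc (suc m) * (suc a * P)                     ∎
  where
  open ℕP.≤-Reasoning
  a = suc t
  p = a ^ m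
  P = suc a ^ m
  p≤P : p ≤ P
  p≤P = ℕP.^-monoˡ-≤ m (ℕP.n≤1+n a)
  factor : ∀ k a P → k * P + k * (a * P) ≡ k * ((1 + a) * P)
  factor = ℕ-solve-∀

binom≤-bound-small : ∀ t d → d ≤ suc t → binom≤ (suc (suc t)) d ≤ 3 * (suc t * suc t ^ d)
binom≤-bound-small t zero    _  = ℕP.≤-trans (s≤s z≤n) (ℕP.m≤n*m (suc t * 1) 3)
binom≤-bound-small t (suc k) d≤s = begin
  binom≤ (suc t) k + binom≤ (suc t) (suc k)   ≤⟨ ℕP.+-mono-≤ (binom≤-bound t k) (binom≤-bound t (suc k)) ⟩
  suc k * s ^ k + suc (suc k) * P             ≤⟨ ℕP.+-mono-≤ (ℕP.≤-trans (ℕP.*-monoˡ-≤ (s ^ k) d≤s) (ℕP.m≤m+n P (t * P)))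
                                                              (ℕP.*-monoˡ-≤ P 2+k≤2s) ⟩
  s * P + (s + s) * P                         ≡⟨ regroup s P ⟩
  3 * (s * P)                                 ∎
  where
  open ℕP.≤-Reasoning
  s = suc t
  P = s ^ suc k
  2+k≤2s : suc (suc k) ≤ s + s
  2+k≤2s = ℕP.≤-trans (s≤s d≤s) (s≤s (ℕP.m≤n+m (suc t) t))
  regroup : ∀ s P → s * P + (s + s) * P ≡ 3 * (s * P)
  regroup = ℕ-solve-∀

insideTails outsideTails : List (Subset (suc n)) → List (Subset n)
insideTails [] = []
insideTails ((inside  ∷ S) ∷ Ss) = S ∷ insideTails Ss
insideTails ((outside ∷ S) ∷ Ss) = insideTails Ss
outsideTails [] = []
outsideTails ((inside  ∷ S) ∷ Ss) = outsideTails Ss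
outsideTails ((outside ∷ S) ∷ Ss) = S ∷ outsideTails Ss

length-tails : (Ss : List (Subset (suc n))) → length Ss ≡ length (insideTails Ss) + length (outsideTails Ss)
length-tails [] = refl
length-tails ((inside  ∷ S) ∷ Ss) = cong suc (length-tails Ss)
length-tails ((outside ∷ S) ∷ Ss) = trans (cong suc (length-tails Ss)) (sym (ℕP.+-suc _ _))

module _ {P : Subset (suc n) → Set} {Q : Subset n → Set} where

  All-insideTails : (∀ S → P (inside ∷ S) → Q S) → ∀ Ss → All P Ss → All Q (insideTails Ss)
  All-insideTails f [] [] = []
  All-insideTails f ((inside  ∷ S) ∷ Ss) (p ∷ ps) = f S p ∷ All-insideTails f Ss ps
  All-insideTails f ((outside ∷ S) ∷ Ss) (p ∷ ps) = All-insideTails f Ss ps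

  All-outsideTails : (∀ S → P (outside ∷ S) → Q S) → ∀ Ss → All P Ss → All Q (outsideTails Ss)
  All-outsideTails f [] [] = []
  All-outsideTails f ((inside  ∷ S) ∷ Ss) (p ∷ ps) = All-outsideTails f Ss ps
  All-outsideTails f ((outside ∷ S) ∷ Ss) (p ∷ ps) = f S p ∷ All-outsideTails f Ss ps

Unique-insideTails : (Ss : List (Subset (suc n))) → Unique Ss → Unique (insideTails Ss)
Unique-insideTails [] [] = []
Unique-insideTails ((inside  ∷ S) ∷ Ss) (S∉Ss ∷ u) =
  All-insideTails (λ S′ ≢S′ → ≢S′ ∘ cong (inside ∷_)) Ss S∉Ss ∷ Unique-insideTails Ss u
Unique-insideTails ((outside ∷ S) ∷ Ss) (_ ∷ u) = Unique-insideTails Ss u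

Unique-outsideTails : (Ss : List (Subset (suc n))) → Unique Ss → Unique (outsideTails Ss)
Unique-outsideTails [] [] = []
Unique-outsideTails ((inside  ∷ S) ∷ Ss) (_ ∷ u) = Unique-outsideTails Ss u
Unique-outsideTails ((outside ∷ S) ∷ Ss) (S∉Ss ∷ u) =
  All-outsideTails (λ S′ ≢S′ → ≢S′ ∘ cong (outside ∷_)) Ss S∉Ss ∷ Unique-outsideTails Ss u

SmallSubsetOf : Subset n → ℕ → Subset n → Set
SmallSubsetOf T m S = S ⊆ T × ∣ S ∣ ≤ m

SmallSubsetOf-tail : ∀ {t b m} {T S : Subset n} → SmallSubsetOf (t ∷ T) m (b ∷ S) → SmallSubsetOf T m S
SmallSubsetOf-tail {b = b} {S = S} (bS⊆tT , ∣bS∣≤m) = drop-∷-⊆ bS⊆tT , ℕP.≤-trans (∣p∣≤∣x∷p∣ b S) ∣bS∣≤m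

SmallSubsetOf-inside : ∀ {t m} {T S : Subset n} → SmallSubsetOf (t ∷ T) (suc m) (inside ∷ S) → SmallSubsetOf T m S
SmallSubsetOf-inside (S⊆T , s≤s ∣S∣≤m) = drop-∷-⊆ S⊆T , ∣S∣≤m

length-unique-small-subsets : (T : Subset n) (m : ℕ) (Ss : List (Subset n)) →
                              Unique Ss → All (SmallSubsetOf T m) Ss → length Ss ≤ binom≤ ∣ T ∣ m
length-unique-small-subsets [] m [] _ _ = z≤n
length-unique-small-subsets [] m ([] ∷ []) _ _ = ℕP.≤-refl
length-unique-small-subsets [] m ([] ∷ [] ∷ _) ((≢[] ∷ _) ∷ _) _ = ⊥-elim (≢[] refl)
length-unique-small-subsets (outside ∷ T) m Ss u small = begin
  length Ss                                           ≡⟨ length-tails Ss ⟩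
  length (insideTails Ss) + length (outsideTails Ss)  ≡⟨ cong (_+ length (outsideTails Ss)) (noInside Ss small) ⟩
  length (outsideTails Ss)                            ≤⟨ outsides ⟩
  binom≤ ∣ T ∣ m                                      ∎
  where
  open ℕP.≤-Reasoning
  outsides = length-unique-small-subsets T m _ (Unique-outsideTails Ss u) (All-outsideTails (λ _ → SmallSubsetOf-tail) Ss small)
  noInside : ∀ Ss → All (SmallSubsetOf (outside ∷ T) m) Ss → length (insideTails Ss) ≡ 0
  noInside [] [] = refl
  noInside ((inside ∷ S) ∷ Ss) ((S⊆T , _) ∷ _) with S⊆T Vec.here
  ... | ()
  noInside ((outside ∷ S) ∷ Ss) (_ ∷ small) = noInside Ss small
length-unique-small-subsets (inside ∷ T) zero Ss u small = begin
  length Ss                                           ≡⟨ length-tails Ss ⟩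
  length (insideTails Ss) + length (outsideTails Ss)  ≡⟨ cong (_+ length (outsideTails Ss)) (noInside Ss small) ⟩
  length (outsideTails Ss)                            ≤⟨ outsides ⟩
  binom≤ ∣ T ∣ 0                                      ≡⟨ binom≤-zero ∣ T ∣ ⟩
  1                                                   ∎
  where
  open ℕP.≤-Reasoning
  outsides = length-unique-small-subsets T 0 _ (Unique-outsideTails Ss u) (All-outsideTails (λ _ → SmallSubsetOf-tail) Ss small)
  noInside : ∀ Ss → All (SmallSubsetOf (inside ∷ T) 0) Ss → length (insideTails Ss) ≡ 0
  noInside [] [] = refl
  noInside ((inside ∷ S) ∷ Ss) ((_ , ()) ∷ _)
  noInside ((outside ∷ S) ∷ Ss) (_ ∷ small) = noInside Ss small
length-unique-small-subsets (inside ∷ T) (suc m) Ss u small = begin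
  length Ss                                           ≡⟨ length-tails Ss ⟩
  length (insideTails Ss) + length (outsideTails Ss)  ≤⟨ ℕP.+-mono-≤ insides outsides ⟩
  binom≤ (∣ T ∣) m + binom≤ (∣ T ∣) (suc m)            ∎
  where
  open ℕP.≤-Reasoning
  insides = length-unique-small-subsets T m _ (Unique-insideTails Ss u) (All-insideTails (λ _ → SmallSubsetOf-inside) Ss small)
  outsides = length-unique-small-subsets T (suc m) _ (Unique-outsideTails Ss u) (All-outsideTails (λ _ → SmallSubsetOf-tail) Ss small)

maxOver-≥ : (f : Fin n → ℕ) (u : Fin n) → f u ≤ maxOver f
maxOver-≥ f u = go (λ i → i) u
  where
  go : ∀ {m} (g : Fin m → Fin _) i → f (g i) ≤ List.foldr (λ v k → f v ⊔ k) 0 (List.tabulate g)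
  go g zero    = ℕP.m≤m⊔n _ _
  go g (suc i) = ℕP.≤-trans (go (g ∘ suc) i) (ℕP.m≤n⊔m _ _)

maxOver-mono : {f g : Fin n → ℕ} → (∀ u → f u ≤ g u) → maxOver f ≤ maxOver g
maxOver-mono {f = f} {g} f≤g = go (λ i → i)
  where
  go : ∀ {m} (h : Fin m → Fin _) →
       List.foldr (λ v k → f v ⊔ k) 0 (List.tabulate h) ≤ List.foldr (λ v k → g v ⊔ k) 0 (List.tabulate h)
  go {zero}  h = z≤n
  go {suc m} h = ℕP.⊔-mono-≤ (f≤g (h zero)) (go (h ∘ suc))

module GraphParameters (G : Graph n) where

  lookup-N⁻ : ∀ u v → lookup (N⁻ G u) v ≡ (adj G u v ∧ ltᵇ v u)
  lookup-N⁻ u v = lookup∘tabulate _ v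

  lookup-N⁻[] : ∀ u v → lookup (N⁻[ G ] u) v ≡ ((adj G u v ∧ ltᵇ v u) ∨ eqᵇ v u)
  lookup-N⁻[] u v = lookup∘tabulate _ v

  N⁻[]-self : ∀ u → lookup (N⁻[ G ] u) u ≡ true
  N⁻[]-self u = trans (lookup-N⁻[] u u) (trans (cong ((adj G u u ∧ ltᵇ u u) ∨_) (eqᵇ-refl u)) (∨-zeroʳ _))

  ∣N⁻∣≤d : ∀ u → ∣ N⁻ G u ∣ ≤ dG G
  ∣N⁻∣≤d = maxOver-≥ (λ u → ∣ N⁻ G u ∣)

  ∣S²∣≤s₂ : ∀ u → ∣ S² G u ∣ ≤ s₂G G
  ∣S²∣≤s₂ = maxOver-≥ (λ u → ∣ S² G u ∣)

  N⁻⊆S² : ∀ u v → lookup (N⁻ G u) v ≡ true → lookup (S² G u) v ≡ true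
  N⁻⊆S² u v v∈N⁻u = trans (lookup∘tabulate _ v) (reorder (adj G u v) (ltᵇ v u) (trans (sym (lookup-N⁻ u v)) v∈N⁻u))
    where
    reorder : ∀ a b {c} → (a ∧ b) ≡ true → (b ∧ (a ∨ c)) ≡ true
    reorder true true _ = refl

  d≤s₂ : dG G ≤ s₂G G
  d≤s₂ = maxOver-mono (λ u → ∣∣-mono {A = N⁻ G u} {S² G u} (N⁻⊆S² u))

  N⁻-nonempty⇒s₂-positive : ∀ u v → lookup (N⁻ G u) v ≡ true → 1 ≤ s₂G G
  N⁻-nonempty⇒s₂-positive u v v∈N⁻u =
    ℕP.≤-trans (member⇒∣∣-positive {S = S² G u} (N⁻⊆S² u v v∈N⁻u)) (∣S²∣≤s₂ u)

  s₂-positive : HasEdge G → 1 ≤ s₂G G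
  s₂-positive (u , v , uv) with ltᵇ u v in u<v
  ... | true  = N⁻-nonempty⇒s₂-positive v u (trans (lookup-N⁻ v u) (cong₂ _∧_ (trans (adj-sym G v u) uv) u<v))
  ... | false = N⁻-nonempty⇒s₂-positive u v (trans (lookup-N⁻ u v) (cong₂ _∧_ uv (ltᵇ-connex u v u≢v u<v)))
    where
    u≢v : u ≢ v
    u≢v refl = true≢false (trans (sym uv) (adj-irr G u))

weighted : (Subset n → ℤ) → Subset n × ℕ → ℤ
weighted f (A , r) = ℤ.+ r *ᶻ f A

∑ₗ-incr : (f : Subset n → ℤ) (k : Subset n) (l : List (Subset n × ℕ)) →
          ∑ₗ (weighted f) (incr k l) ≡ f k +ᶻ ∑ₗ (weighted f) l
∑ₗ-incr f k [] = cong (_+ᶻ 0ℤ) (ℤP.*-identityˡ (f k))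
∑ₗ-incr f k ((k′ , c) ∷ l) with k ≟ₛ k′
... | yes refl = split (ℤ.+ c) (f k) (∑ₗ (weighted f) l)
  where
  split : ∀ c a t → (1ℤ +ᶻ c) *ᶻ a +ᶻ t ≡ a +ᶻ (c *ᶻ a +ᶻ t)
  split = solve-∀
... | no _ = trans (cong (weighted f (k′ , c) +ᶻ_) (∑ₗ-incr f k l)) (swap (weighted f (k′ , c)) (f k) _)
  where
  swap : ∀ a b c → a +ᶻ (b +ᶻ c) ≡ b +ᶻ (a +ᶻ c)
  swap = solve-∀

∑ₗ-Rinit : (f : Subset n → ℤ) (G : Graph n) (x : Fin n) →
           ∑ₗ (weighted f) (Rinit G x) ≡ ∑[ u < n ] (if lookup (N⁻ G u) x then f (N⁻ G u ∩ V≤ x) else 0ℤ)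
∑ₗ-Rinit {n} f G x = begin
  ∑ₗ (weighted f) (Rinit G x)            ≡⟨ foldl-additive _ (∑ₗ (weighted f)) contribution step (allFin n) [] ⟩
  0ℤ +ᶻ ∑ₗ contribution (allFin n)       ≡⟨ ℤP.+-identityˡ _ ⟩
  ∑ₗ contribution (allFin n)             ≡⟨ ∑ₗ-tabulate contribution (λ u → u) ⟩
  ∑[ u < n ] contribution u              ∎
  where
  open ≡-Reasoning
  contribution : Fin n → ℤ
  contribution u = if lookup (N⁻ G u) x then f (N⁻ G u ∩ V≤ x) else 0ℤ
  step : ∀ acc u → ∑ₗ (weighted f) (if lookup (N⁻ G u) x then incr (N⁻ G u ∩ V≤ x) acc else acc)
                   ≡ ∑ₗ (weighted f) acc +ᶻ contribution u
  step acc u with lookup (N⁻ G u) x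
  ... | true  = trans (∑ₗ-incr f (N⁻ G u ∩ V≤ x) acc) (ℤP.+-comm (f (N⁻ G u ∩ V≤ x)) _)
  ... | false = sym (ℤP.+-identityʳ _)

keysOf : List (Subset n × ℕ) → List (Subset n)
keysOf = List.map proj₁

All-incr : {P : Subset n → Set} (k : Subset n) (l : List (Subset n × ℕ)) → All P (keysOf l) → P k → All P (keysOf (incr k l))
All-incr k [] _ Pk = Pk ∷ []
All-incr k ((k′ , c) ∷ l) (Pk′ ∷ Pl) Pk with k ≟ₛ k′
... | yes _ = Pk′ ∷ Pl
... | no _  = Pk′ ∷ All-incr k l Pl Pk

Unique-incr : (k : Subset n) (l : List (Subset n × ℕ)) → Unique (keysOf l) → Unique (keysOf (incr k l))
Unique-incr k [] _ = [] ∷ []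
Unique-incr k ((k′ , c) ∷ l) (k′∉l ∷ u) with k ≟ₛ k′
... | yes _   = k′∉l ∷ u
... | no k≢k′ = All-incr k l k′∉l (k≢k′ ∘ sym) ∷ Unique-incr k l u

VertexArray : ℕ → Set
VertexArray n = List (Fin n × Subset n)

DistinctKeys : VertexArray n → Set
DistinctKeys []            = ⊤
DistinctKeys ((v , _) ∷ L) = L-find v L ≡ false × DistinctKeys L

insert : Fin n → Subset n → Subset n
insert x S = Vec.updateAt S x (λ _ → true)

lookup-insert : (x : Fin n) (S : Subset n) (w : Fin n) → lookup (insert x S) w ≡ (eqᵇ w x ∨ lookup S w)
lookup-insert x S w with w FinP.≟ x
... | yes refl = lookup∘updateAt w S
... | no w≢x   = lookup∘updateAt′ w x w≢x S

∣insert∣≤ : (x : Fin n) (S : Subset n) → ∣ insert x S ∣ ≤ suc ∣ S ∣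
∣insert∣≤ x S = ∣∣-insert {A = insert x S} {S} x λ w w∈ → case (trans (sym (lookup-insert x S w)) w∈)
  where
  case : ∀ {w} → (eqᵇ w x ∨ lookup S w) ≡ true → lookup S w ≡ true ⊎ w ≡ x
  case {w} h with eqᵇ w x in w=x
  ... | true  = inj₂ (eqᵇ⇒≡ w=x)
  ... | false = inj₁ h

L-find-addTo : (u x v : Fin n) (L : VertexArray n) → L-find v (L-addTo u x L) ≡ L-find v L
L-find-addTo u x v [] = refl
L-find-addTo u x v ((w , S) ∷ L) with eqᵇ u w
... | true  = refl
... | false = cong (eqᵇ v w ∨_) (L-find-addTo u x v L)

DistinctKeys-addTo : (u x : Fin n) (L : VertexArray n) → DistinctKeys L → DistinctKeys (L-addTo u x L)
DistinctKeys-addTo u x [] _ = tt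
DistinctKeys-addTo u x ((w , S) ∷ L) (w∉L , distinct) with eqᵇ u w
... | true  = w∉L , distinct
... | false = trans (L-find-addTo u x w L) w∉L , DistinctKeys-addTo u x L distinct

L-find-++ : (v : Fin n) (L E : VertexArray n) → L-find v (L ++ E) ≡ (L-find v L ∨ L-find v E)
L-find-++ v []            E = refl
L-find-++ v ((w , S) ∷ L) E = trans (cong (eqᵇ v w ∨_) (L-find-++ v L E)) (sym (∨-assoc (eqᵇ v w) _ _))

L-addTo-++ : (u x : Fin n) (L E : VertexArray n) → L-find u L ≡ false → L-addTo u x (L ++ E) ≡ L ++ L-addTo u x E
L-addTo-++ u x [] E _ = refl
L-addTo-++ u x ((w , S) ∷ L) E u∉ with eqᵇ u w
... | false = cong ((w , S) ∷_) (L-addTo-++ u x L E u∉)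
L-addTo-++ u x ((w , S) ∷ L) E () | true

DistinctKeys-snoc : (u : Fin n) (S : Subset n) (L : VertexArray n) →
                    DistinctKeys L → L-find u L ≡ false → DistinctKeys (L ++ (u , S) ∷ [])
DistinctKeys-snoc u S [] _ _ = refl , tt
DistinctKeys-snoc u S ((w , T) ∷ L) (w∉L , distinct) u∉ with eqᵇ u w in u=w
... | false = w∉L++u , DistinctKeys-snoc u S L distinct u∉
  where
  w∉L++u : L-find w (L ++ (u , S) ∷ []) ≡ false
  w∉L++u = trans (L-find-++ w L _) (trans (cong₂ _∨_ w∉L (trans (∨-identityʳ _) (trans (eqᵇ-sym w u) u=w))) refl)
DistinctKeys-snoc u S ((w , T) ∷ L) _ () | true

weight : VertexArray n → ℕ
weight []            = 0
weight ((u , S) ∷ L) = (2 + ∣ S ∣) + weight L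

weight-addTo : (u x : Fin n) (L : VertexArray n) → weight (L-addTo u x L) ≤ 1 + weight L
weight-addTo u x [] = z≤n
weight-addTo u x ((v , S) ∷ L) with eqᵇ u v
... | true  = ℕP.+-monoˡ-≤ (weight L) (s≤s (s≤s (∣insert∣≤ x S)))
... | false = ℕP.≤-trans (ℕP.+-monoʳ-≤ (2 + ∣ S ∣) (weight-addTo u x L)) (ℕP.≤-reflexive (ℕP.+-suc (2 + ∣ S ∣) (weight L)))

weight-++ : (L E : VertexArray n) → weight (L ++ E) ≡ weight L + weight E
weight-++ []            E = refl
weight-++ ((u , S) ∷ L) E = trans (cong ((2 + ∣ S ∣) +_) (weight-++ L E)) (sym (ℕP.+-assoc (2 + ∣ S ∣) (weight L) (weight E)))

∑ₗ-keys : (h : Fin n → ℤ) (L : VertexArray n) → DistinctKeys L →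
          ∑ₗ (h ∘ proj₁) L ≡ ∑[ v < n ] (if L-find v L then h v else 0ℤ)
∑ₗ-keys {n} h [] _ = sym (sum-replicate-zero n)
∑ₗ-keys {n} h ((u , S) ∷ L) (u∉L , distinct) = begin
  h u +ᶻ ∑ₗ (h ∘ proj₁) L
    ≡⟨ cong₂ _+ᶻ_ (sym (∑-point u h)) (∑ₗ-keys h L distinct) ⟩
  ∑[ v < n ] (if eqᵇ v u then h v else 0ℤ) +ᶻ ∑[ v < n ] (if L-find v L then h v else 0ℤ)
    ≡⟨ ∑-distrib-+ (λ v → if eqᵇ v u then h v else 0ℤ) (λ v → if L-find v L then h v else 0ℤ) ⟨
  ∑[ v < n ] ((if eqᵇ v u then h v else 0ℤ) +ᶻ (if L-find v L then h v else 0ℤ))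
    ≡⟨ sum-cong-≗ disjoint ⟩
  ∑[ v < n ] (if eqᵇ v u ∨ L-find v L then h v else 0ℤ) ∎
  where
  open ≡-Reasoning
  disjoint : ∀ v → (if eqᵇ v u then h v else 0ℤ) +ᶻ (if L-find v L then h v else 0ℤ)
                   ≡ (if eqᵇ v u ∨ L-find v L then h v else 0ℤ)
  disjoint v with eqᵇ v u in v=u
  ... | true rewrite eqᵇ⇒≡ v=u | u∉L = ℤP.+-identityʳ (h u)
  ... | false = ℤP.+-identityˡ _

-- Correctness

module QueryRun (G : Graph n) (X : Subset n) where
  open Query G (Rinit G) X public

  s₁ s₂ : State {n}
  s₁ = foldl step1 init xs
  s₂ = foldl step2 s₁ xs

  L-s₁ : L s₁ ≡ []
  L-s₁ = foldl-invariant (λ s → L s ≡ []) step1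
           (λ s x L≡[] → foldl-invariant (λ s′ → L s′ ≡ []) step1-key (λ _ _ L≡[] → L≡[]) (Rinit G x) (tick 1 s) L≡[])
           xs init refl

module KeyCount (G : Graph n) (X Z : Subset n) where
  open QueryRun G X
  open GraphParameters G

  δ : Subset n → ℤ
  δ A = if ⌊ Z ≟ₛ A ⌋ then 1ℤ else 0ℤ

  addTr-δ : ∀ S z T → addTr S z T Z ≡ T Z +ᶻ z *ᶻ δ S
  addTr-δ S z T with ⌊ Z ≟ₛ S ⌋
  ... | true  = cong (T Z +ᶻ_) (sym (ℤP.*-identityʳ z))
  ... | false = sym (trans (cong (T Z +ᶻ_) (ℤP.*-zeroʳ z)) (ℤP.+-identityʳ _))

  jump : Subset n → ℤ
  jump A = δ (A ∩ X) -ᶻ δ (removeMax {n} (A ∩ X))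

  step1-key-Tr : ∀ s a → Tr (step1-key s a) Z ≡ Tr s Z +ᶻ weighted jump a
  step1-key-Tr s (A , r) = begin
    addTr M (-ᶻ ℤ.+ r) (addTr S (ℤ.+ r) (Tr s)) Z      ≡⟨ addTr-δ M (-ᶻ ℤ.+ r) (addTr S (ℤ.+ r) (Tr s)) ⟩
    addTr S (ℤ.+ r) (Tr s) Z +ᶻ -ᶻ ℤ.+ r *ᶻ δ M         ≡⟨ cong (_+ᶻ -ᶻ ℤ.+ r *ᶻ δ M) (addTr-δ S (ℤ.+ r) (Tr s)) ⟩
    Tr s Z +ᶻ ℤ.+ r *ᶻ δ S +ᶻ -ᶻ ℤ.+ r *ᶻ δ M           ≡⟨ factor (Tr s Z) (ℤ.+ r) (δ S) (δ M) ⟩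
    Tr s Z +ᶻ ℤ.+ r *ᶻ (δ S -ᶻ δ M)                     ∎
    where
    open ≡-Reasoning
    S = A ∩ X
    M = removeMax {n} S
    factor : ∀ t r a b → t +ᶻ r *ᶻ a +ᶻ -ᶻ r *ᶻ b ≡ t +ᶻ r *ᶻ (a -ᶻ b)
    factor = solve-∀

  jumpsAt : Fin n → Fin n → ℤ
  jumpsAt x u = if lookup (N⁻ G u) x then jump (N⁻ G u ∩ V≤ x) else 0ℤ

  step1-Tr : ∀ s x → Tr (step1 s x) Z ≡ Tr s Z +ᶻ ∑[ u < n ] jumpsAt x u
  step1-Tr s x = trans (foldl-additive step1-key (λ s → Tr s Z) (weighted jump) step1-key-Tr (Rinit G x) (tick 1 s))
                       (cong (Tr s Z +ᶻ_) (∑ₗ-Rinit jump G x))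

  prefix-skip-δ : ∀ A x → lookup A x ≡ false → 0ℤ ≡ δ (prefix A (suc (toℕ x))) -ᶻ δ (prefix A (toℕ x))
  prefix-skip-δ A x x∉A = begin
    0ℤ                                                ≡⟨ ℤP.+-inverseʳ (δ (prefix A (toℕ x))) ⟨
    δ (prefix A (toℕ x)) -ᶻ δ (prefix A (toℕ x))       ≡⟨ cong (λ B → δ B -ᶻ δ (prefix A (toℕ x))) (prefix-skip A x x∉A) ⟨
    δ (prefix A (suc (toℕ x))) -ᶻ δ (prefix A (toℕ x)) ∎
    where open ≡-Reasoning

  jumpsAt-telescopes : ∀ u x → (if lookup X x then jumpsAt x u else 0ℤ)
                               ≡ δ (prefix (N⁻ G u ∩ X) (suc (toℕ x))) -ᶻ δ (prefix (N⁻ G u ∩ X) (toℕ x))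
  jumpsAt-telescopes u x with lookup X x in x∈X | lookup (N⁻ G u) x in x∈N⁻u
  ... | true  | true  = cong₂ (λ A B → δ A -ᶻ δ B) (prefix-∩-V≤ (N⁻ G u) X x)
                              (trans (cong (removeMax {n}) (prefix-∩-V≤ (N⁻ G u) X x)) (removeMax-prefix (N⁻ G u ∩ X) x x∈))
    where x∈ = trans (lookup-∩ (N⁻ G u) X x) (cong₂ _∧_ x∈N⁻u x∈X)
  ... | true  | false = prefix-skip-δ (N⁻ G u ∩ X) x (trans (lookup-∩ (N⁻ G u) X x) (cong (_∧ lookup X x) x∈N⁻u))
  ... | false | _     = prefix-skip-δ (N⁻ G u ∩ X) x
                              (trans (lookup-∩ (N⁻ G u) X x) (trans (cong (lookup (N⁻ G u) x ∧_) x∈X) (∧-zeroʳ _)))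

  ∑-jumps : ∀ u → ∑[ x < n ] (if lookup X x then jumpsAt x u else 0ℤ) ≡ δ (N⁻ G u ∩ X) -ᶻ δ ⊥
  ∑-jumps u = begin
    ∑[ x < n ] (if lookup X x then jumpsAt x u else 0ℤ)                     ≡⟨ sum-cong-≗ (jumpsAt-telescopes u) ⟩
    ∑[ x < n ] (δ (P (suc (toℕ x))) -ᶻ δ (P (toℕ x)))                        ≡⟨ ∑-telescope (δ ∘ P) ⟩
    δ (P n) -ᶻ δ (P 0)                                                      ≡⟨ cong₂ (λ A B → δ A -ᶻ δ B) (prefix-n (N⁻ G u ∩ X)) (prefix-0 (N⁻ G u ∩ X)) ⟩
    δ (N⁻ G u ∩ X) -ᶻ δ ⊥                                                   ∎
    where
    open ≡-Reasoning
    P = prefix (N⁻ G u ∩ X)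

  Tr-after-step1 : Tr s₁ Z ≡ ∑[ u < n ] δ (N⁻ G u ∩ X)
  Tr-after-step1 = begin
    Tr s₁ Z
      ≡⟨ foldl-additive step1 (λ s → Tr s Z) (λ x → ∑[ u < n ] jumpsAt x u) step1-Tr xs init ⟩
    Tr init Z +ᶻ ∑ₗ (λ x → ∑[ u < n ] jumpsAt x u) xs
      ≡⟨ cong₂ _+ᶻ_ (trans (addTr-δ ⊥ (ℤ.+ n) (λ _ → 0ℤ)) (ℤP.+-identityˡ (ℤ.+ n *ᶻ δ ⊥))) (∑ₗ-elems (λ x → ∑[ u < n ] jumpsAt x u) X) ⟩
    ℤ.+ n *ᶻ δ ⊥ +ᶻ ∑[ x < n ] (if lookup X x then ∑[ u < n ] jumpsAt x u else 0ℤ)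
      ≡⟨ cong₂ _+ᶻ_ (sym (∑-const {n} (δ ⊥))) (sum-cong-≗ λ x → if-∑ (lookup X x) (jumpsAt x)) ⟩
    ∑[ u < n ] δ ⊥ +ᶻ ∑[ x < n ] ∑[ u < n ] (if lookup X x then jumpsAt x u else 0ℤ)
      ≡⟨ cong (∑[ u < n ] δ ⊥ +ᶻ_) (trans (∑-comm (λ x u → if lookup X x then jumpsAt x u else 0ℤ)) (sum-cong-≗ ∑-jumps)) ⟩
    ∑[ u < n ] δ ⊥ +ᶻ ∑[ u < n ] (δ (N⁻ G u ∩ X) -ᶻ δ ⊥)
      ≡⟨ ∑-distrib-+ (λ _ → δ ⊥) (λ u → δ (N⁻ G u ∩ X) -ᶻ δ ⊥) ⟨
    ∑[ u < n ] (δ ⊥ +ᶻ (δ (N⁻ G u ∩ X) -ᶻ δ ⊥))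
      ≡⟨ sum-cong-≗ (λ u → cancel (δ ⊥) (δ (N⁻ G u ∩ X))) ⟩
    ∑[ u < n ] δ (N⁻ G u ∩ X)
      ∎
    where
    open ≡-Reasoning
    if-∑ : ∀ b (f : Fin n → ℤ) → (if b then ∑[ u < n ] f u else 0ℤ) ≡ ∑[ u < n ] (if b then f u else 0ℤ)
    if-∑ true  f = refl
    if-∑ false f = sym (sum-replicate-zero n)
    cancel : ∀ a b → a +ᶻ (b -ᶻ a) ≡ b
    cancel = solve-∀

  -- In the invariant of step (2), M v says that v is a key of L, and P w v that the
  -- pair (w, v) with w ∈ X and v ∈ N⁻[w] has been processed.
  Entry : (Fin n → Fin n → Bool) → Fin n × Subset n → Set
  Entry P (v , S) = ∀ w → lookup S w ≡ (lookup (N⁻ G v ∩ X) w ∨ P w v)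

  keyWeight : VertexArray n → ℤ
  keyWeight = ∑ₗ (λ e → δ (N⁻ G (proj₁ e) ∩ X))

  record Step2Invariant (s : State) (M : Fin n → Bool) (P : Fin n → Fin n → Bool) : Set where
    field
      keys     : ∀ v → L-find v (L s) ≡ M v
      distinct : DistinctKeys (L s)
      entries  : All (Entry P) (L s)
      P⇒M      : ∀ w v → P w v ≡ true → M v ≡ true
      balance  : Tr s Z +ᶻ keyWeight (L s) ≡ Tr s₁ Z

  Step2Invariant-cong : ∀ {s M P M′ P′} → (∀ v → M v ≡ M′ v) → (∀ w v → P w v ≡ P′ w v) →
                        Step2Invariant s M P → Step2Invariant s M′ P′
  Step2Invariant-cong {s} {M} {P} {M′} {P′} M≗M′ P≗P′ I = record
    { keys     = λ v → trans (keys v) (M≗M′ v)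
    ; distinct = distinct
    ; entries  = All.map (λ {e} → entry-cong e) entries
    ; P⇒M      = λ w v P′wv → trans (sym (M≗M′ v)) (P⇒M w v (trans (P≗P′ w v) P′wv))
    ; balance  = balance
    }
    where
    open Step2Invariant I
    entry-cong : ∀ e → Entry P e → Entry P′ e
    entry-cong (v , S) entry w = trans (entry w) (cong (lookup (N⁻ G v ∩ X) w ∨_) (P≗P′ w v))

  Step2Invariant-tick : ∀ {s M P} → Step2Invariant s M P → Step2Invariant (tick 1 s) M P
  Step2Invariant-tick I = record { Step2Invariant I }

  extend : (Fin n → Fin n → Bool) → Fin n → Fin n → Fin n → Fin n → Bool
  extend P x u w v = P w v ∨ (eqᵇ w x ∧ eqᵇ v u)

  extend-P⇒M : ∀ (M : Fin n → Bool) P x u → (∀ w v → P w v ≡ true → M v ≡ true) →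
               ∀ w v → extend P x u w v ≡ true → (M v ∨ eqᵇ v u) ≡ true
  extend-P⇒M M P x u P⇒M w v ext with P w v in Pwv
  ... | true  = cong (_∨ eqᵇ v u) (P⇒M w v Pwv)
  ... | false = trans (cong (M v ∨_) (∧-conicalʳ (eqᵇ w x) (eqᵇ v u) ext)) (∨-zeroʳ (M v))

  Entry-extend : ∀ (P : Fin n → Fin n → Bool) x u v S → eqᵇ u v ≡ false → Entry P (v , S) → Entry (extend P x u) (v , S)
  Entry-extend P x u v S u≠v entry w = trans (entry w) (cong (lookup (N⁻ G v ∩ X) w ∨_) (sym noNewPair))
    where
    noNewPair : (P w v ∨ (eqᵇ w x ∧ eqᵇ v u)) ≡ P w v
    noNewPair = trans (cong (λ b → P w v ∨ (eqᵇ w x ∧ b)) (trans (eqᵇ-sym v u) u≠v))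
                      (trans (cong (P w v ∨_) (∧-zeroʳ _)) (∨-identityʳ _))

  All-Entry-extend : ∀ (P : Fin n → Fin n → Bool) x u (L : VertexArray n) → L-find u L ≡ false →
                     All (Entry P) L → All (Entry (extend P x u)) L
  All-Entry-extend P x u [] _ [] = []
  All-Entry-extend P x u ((v , S) ∷ L) u∉ (entry ∷ entries) =
    Entry-extend P x u v S (∨-conicalˡ _ _ u∉) entry ∷ All-Entry-extend P x u L (∨-conicalʳ _ _ u∉) entries

  All-Entry-addTo : ∀ (P : Fin n → Fin n → Bool) x u (L : VertexArray n) → DistinctKeys L → All (Entry P) L →
                    All (Entry (extend P x u)) (L-addTo u x L)
  All-Entry-addTo P x u [] _ [] = []
  All-Entry-addTo P x u ((v , S) ∷ L) (v∉L , distinct) (entry ∷ entries) with eqᵇ u v in u=v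
  ... | true rewrite eqᵇ⇒≡ u=v = inserted ∷ All-Entry-extend P x v L v∉L entries
    where
    inserted : Entry (extend P x v) (v , insert x S)
    inserted w = trans (lookup-insert x S w) (trans (cong (eqᵇ w x ∨_) (entry w))
                       (absorb (eqᵇ w x) (lookup (N⁻ G v ∩ X) w) (P w v) (eqᵇ-refl v)))
      where
      absorb : ∀ c a b {t} → t ≡ true → (c ∨ (a ∨ b)) ≡ (a ∨ (b ∨ (c ∧ t)))
      absorb true  true  b refl = refl
      absorb true  false b refl = sym (∨-zeroʳ b)
      absorb false a     b refl = cong (a ∨_) (sym (∨-identityʳ b))
  ... | false = Entry-extend P x u v S u=v entry ∷ All-Entry-addTo P x u L distinct entries

  keyWeight-addTo : ∀ u x (L : VertexArray n) → keyWeight (L-addTo u x L) ≡ keyWeight L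
  keyWeight-addTo u x [] = refl
  keyWeight-addTo u x ((v , S) ∷ L) with eqᵇ u v
  ... | true  = refl
  ... | false = cong (δ (N⁻ G v ∩ X) +ᶻ_) (keyWeight-addTo u x L)

  Step2Invariant-revisit : ∀ x u s M P c → L-find u (L s) ≡ true → Step2Invariant s M P →
                           Step2Invariant (st (Tr s) (L-addTo u x (L s)) c) (λ v → M v ∨ eqᵇ v u) (extend P x u)
  Step2Invariant-revisit x u s M P c u∈L I = record
    { keys     = λ v → trans (L-find-addTo u x v (L s)) (trans (keys v) (Mu-absorbs v))
    ; distinct = DistinctKeys-addTo u x (L s) distinct
    ; entries  = All-Entry-addTo P x u (L s) distinct entries
    ; P⇒M      = extend-P⇒M M P x u P⇒M
    ; balance  = trans (cong (Tr s Z +ᶻ_) (keyWeight-addTo u x (L s))) balance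
    }
    where
    open Step2Invariant I
    Mu-absorbs : ∀ v → M v ≡ (M v ∨ eqᵇ v u)
    Mu-absorbs v with eqᵇ v u in v=u
    ... | false = sym (∨-identityʳ (M v))
    ... | true rewrite eqᵇ⇒≡ v=u = trans (trans (sym (keys u)) u∈L) (sym (∨-zeroʳ (M u)))

  Entry-new : ∀ (P : Fin n → Fin n → Bool) x u → (∀ w → P w u ≡ false) → Entry (extend P x u) (u , insert x (N⁻ G u ∩ X))
  Entry-new P x u P-u w = begin
    lookup (insert x S) w                              ≡⟨ lookup-insert x S w ⟩
    eqᵇ w x ∨ lookup S w                               ≡⟨ swap (eqᵇ w x) (lookup S w) (eqᵇ-refl u) ⟩
    lookup S w ∨ (false ∨ (eqᵇ w x ∧ eqᵇ u u))          ≡⟨ cong (λ b → lookup S w ∨ (b ∨ (eqᵇ w x ∧ eqᵇ u u))) (P-u w) ⟨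
    lookup S w ∨ (P w u ∨ (eqᵇ w x ∧ eqᵇ u u))          ∎
    where
    open ≡-Reasoning
    S = N⁻ G u ∩ X
    swap : ∀ a b {t} → t ≡ true → (a ∨ b) ≡ (b ∨ (false ∨ (a ∧ t)))
    swap true  true  refl = refl
    swap true  false refl = refl
    swap false b     refl = sym (∨-identityʳ b)

  Step2Invariant-insert : ∀ x u s M P c → L-find u (L s) ≡ false → Step2Invariant s M P →
                          let S = N⁻ G u ∩ X in
                          Step2Invariant (st (addTr S (-ᶻ 1ℤ) (Tr s)) (L-addTo u x (L s ++ (u , S) ∷ [])) c)
                                         (λ v → M v ∨ eqᵇ v u) (extend P x u)
  Step2Invariant-insert x u s M P c u∉L I = record
    { keys     = λ v → trans (cong (L-find v) L′≡) (trans (L-find-++ v (L s) _) (cong₂ _∨_ (keys v) (∨-identityʳ _)))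
    ; distinct = subst DistinctKeys (sym L′≡) (DistinctKeys-snoc u (insert x S) (L s) distinct u∉L)
    ; entries  = subst (All (Entry (extend P x u))) (sym L′≡)
                       (++⁺ (All-Entry-extend P x u (L s) u∉L entries) (Entry-new P x u P-u ∷ []))
    ; P⇒M      = extend-P⇒M M P x u P⇒M
    ; balance  = begin
        addTr S (-ᶻ 1ℤ) (Tr s) Z +ᶻ keyWeight (L-addTo u x (L s ++ (u , S) ∷ []))
          ≡⟨ cong₂ _+ᶻ_ (addTr-δ S (-ᶻ 1ℤ) (Tr s)) (trans (cong keyWeight L′≡) (∑ₗ-++ (λ e → δ (N⁻ G (proj₁ e) ∩ X)) (L s) _)) ⟩
        Tr s Z +ᶻ -ᶻ 1ℤ *ᶻ δ S +ᶻ (keyWeight (L s) +ᶻ (δ S +ᶻ 0ℤ))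
          ≡⟨ cancel (Tr s Z) (keyWeight (L s)) (δ S) ⟩
        Tr s Z +ᶻ keyWeight (L s)
          ≡⟨ balance ⟩
        Tr s₁ Z ∎
    }
    where
    open ≡-Reasoning
    open Step2Invariant I
    S = N⁻ G u ∩ X
    L′≡ : L-addTo u x (L s ++ (u , S) ∷ []) ≡ L s ++ (u , insert x S) ∷ []
    L′≡ = trans (L-addTo-++ u x (L s) _ u∉L)
                (cong (λ b → L s ++ (if b then (u , insert x S) ∷ [] else (u , S) ∷ [])) (eqᵇ-refl u))
    P-u : ∀ w → P w u ≡ false
    P-u w with P w u in Pwu
    ... | false = refl
    ... | true  = ⊥-elim (true≢false (trans (sym (P⇒M w u Pwu)) (trans (sym (keys u)) u∉L)))
    cancel : ∀ t k d → t +ᶻ -ᶻ 1ℤ *ᶻ d +ᶻ (k +ᶻ (d +ᶻ 0ℤ)) ≡ t +ᶻ k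
    cancel = solve-∀

  Step2Invariant-step : ∀ x u s M P → Step2Invariant s M P →
                        Step2Invariant (step2-u x s u) (λ v → M v ∨ eqᵇ v u) (extend P x u)
  Step2Invariant-step x u s M P I with L-find u (L s) in u∈L
  ... | true  = Step2Invariant-revisit x u s M P _ u∈L I
  ... | false = Step2Invariant-insert x u s M P _ u∈L I

  Step2Invariant-inner : ∀ x l s M P → Step2Invariant s M P →
                         Step2Invariant (foldl (step2-u x) s l) (λ v → M v ∨ memberᵇ v l) (λ w v → P w v ∨ (eqᵇ w x ∧ memberᵇ v l))
  Step2Invariant-inner x [] s M P I =
    Step2Invariant-cong (λ v → sym (∨-identityʳ (M v))) (λ w v → sym (trans (cong (P w v ∨_) (∧-zeroʳ _)) (∨-identityʳ _))) I
  Step2Invariant-inner x (u ∷ l) s M P I =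
    Step2Invariant-cong (λ v → ∨-assoc (M v) (eqᵇ v u) (memberᵇ v l)) (λ w v → regroup (P w v) (eqᵇ w x) (eqᵇ v u) (memberᵇ v l))
      (Step2Invariant-inner x l (step2-u x s u) _ _ (Step2Invariant-step x u s M P I))
    where
    regroup : ∀ p a b c → ((p ∨ (a ∧ b)) ∨ (a ∧ c)) ≡ (p ∨ (a ∧ (b ∨ c)))
    regroup true  a     b c = refl
    regroup false true  b c = refl
    regroup false false b c = refl

  Step2Invariant-outer : ∀ l s M P → Step2Invariant s M P →
                         Step2Invariant (foldl step2 s l) (λ v → M v ∨ BL.any (λ x → lookup (N⁻[ G ] x) v) l)
                                        (λ w v → P w v ∨ (memberᵇ w l ∧ lookup (N⁻[ G ] w) v))
  Step2Invariant-outer [] s M P I = Step2Invariant-cong (λ v → sym (∨-identityʳ (M v))) (λ w v → sym (∨-identityʳ (P w v))) I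
  Step2Invariant-outer (x ∷ l) s M P I =
    Step2Invariant-cong (λ v → trans (cong (λ b → (M v ∨ b) ∨ _) (memberᵇ-elems (N⁻[ G ] x) v)) (∨-assoc (M v) _ _)) regroup
      (Step2Invariant-outer l (step2 s x) _ _ (Step2Invariant-inner x (elems (N⁻[ G ] x)) (tick 1 s) M P (Step2Invariant-tick I)))
    where
    regroup : ∀ w v → ((P w v ∨ (eqᵇ w x ∧ memberᵇ v (elems (N⁻[ G ] x)))) ∨ (memberᵇ w l ∧ lookup (N⁻[ G ] w) v))
                      ≡ (P w v ∨ ((eqᵇ w x ∨ memberᵇ w l) ∧ lookup (N⁻[ G ] w) v))
    regroup w v rewrite memberᵇ-elems (N⁻[ G ] x) v with eqᵇ w x in w=x
    ... | true rewrite eqᵇ⇒≡ w=x = absorb (P x v) (lookup (N⁻[ G ] x) v) (memberᵇ x l)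
      where
      absorb : ∀ p a b → ((p ∨ a) ∨ (b ∧ a)) ≡ (p ∨ a)
      absorb true  a     b = refl
      absorb false true  b = refl
      absorb false false b = ∧-zeroʳ b
    ... | false = cong (_∨ (memberᵇ w l ∧ lookup (N⁻[ G ] w) v)) (∨-identityʳ (P w v))

  Step2Invariant-s₁ : Step2Invariant s₁ (λ _ → false) (λ _ _ → false)
  Step2Invariant-s₁ = record
    { keys     = λ v → cong (L-find v) L-s₁
    ; distinct = subst DistinctKeys (sym L-s₁) tt
    ; entries  = subst (All _) (sym L-s₁) []
    ; P⇒M      = λ _ _ ()
    ; balance  = trans (cong (λ L₀ → Tr s₁ Z +ᶻ keyWeight L₀) L-s₁) (ℤP.+-identityʳ _)
    }

  visited : Fin n → Bool
  visited v = BL.any (λ x → lookup (N⁻[ G ] x) v) xs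

  processed : Fin n → Fin n → Bool
  processed w v = memberᵇ w xs ∧ lookup (N⁻[ G ] w) v

  Step2Invariant-s₂ : Step2Invariant s₂ visited processed
  Step2Invariant-s₂ = Step2Invariant-outer xs s₁ _ _ Step2Invariant-s₁

  visited-intro : ∀ x v → lookup X x ≡ true → lookup (N⁻[ G ] x) v ≡ true → visited v ≡ true
  visited-intro x v x∈X v∈N⁻[x] = any-memberᵇ (λ x → lookup (N⁻[ G ] x) v) x xs (trans (memberᵇ-elems X x) x∈X) v∈N⁻[x]

  -- For v ∉ X, step (2) adds to N⁻(v) ∩ X exactly the neighbours of v in X above v.
  entry-outside : ∀ v → lookup X v ≡ false → ∀ w → (lookup (N⁻ G v ∩ X) w ∨ processed w v) ≡ lookup (Nb G v ∩ X) w
  entry-outside v v∉X w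
    rewrite lookup-∩ (N⁻ G v) X w | lookup-∩ (Nb G v) X w | lookup-N⁻ v w | lookup∘tabulate (adj G v) w
          | memberᵇ-elems X w | lookup-N⁻[] w v
    with w FinP.≟ v
  ... | yes refl rewrite v∉X = trans (cong (_∨ false) (∧-zeroʳ _)) (sym (∧-zeroʳ _))
  ... | no w≢v rewrite eqᵇ-≢ (w≢v ∘ sym) | adj-sym G w v with ltᵇ w v in w<v
  ...   | true  = split (adj G v w) (lookup X w) (ltᵇ v w)
    where
    split : ∀ a x l → ((a ∧ true) ∧ x) ∨ (x ∧ ((a ∧ l) ∨ false)) ≡ (a ∧ x)
    split true  true  l = refl
    split true  false l = refl
    split false x     l = ∧-zeroʳ x
  ...   | false rewrite ltᵇ-connex w v w≢v w<v = split (adj G v w) (lookup X w)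
    where
    split : ∀ a x → ((a ∧ false) ∧ x) ∨ (x ∧ ((a ∧ true) ∨ false)) ≡ (a ∧ x)
    split true  true  = refl
    split true  false = refl
    split false x     = ∧-zeroʳ x

  N⁻∩X-unvisited : ∀ v → visited v ≡ false → N⁻ G v ∩ X ≡ Nb G v ∩ X
  N⁻∩X-unvisited v unvisited = lookup-ext λ w → begin
    lookup (N⁻ G v ∩ X) w               ≡⟨ trans (lookup-∩ (N⁻ G v) X w) (cong (_∧ lookup X w) (lookup-N⁻ v w)) ⟩
    (adj G v w ∧ ltᵇ w v) ∧ lookup X w  ≡⟨ below w ⟩
    adj G v w ∧ lookup X w              ≡⟨ trans (lookup-∩ (Nb G v) X w) (cong (_∧ lookup X w) (lookup∘tabulate (adj G v) w)) ⟨
    lookup (Nb G v ∩ X) w               ∎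
    where
    open ≡-Reasoning
    below : ∀ w → ((adj G v w ∧ ltᵇ w v) ∧ lookup X w) ≡ (adj G v w ∧ lookup X w)
    below w with adj G v w in vw | lookup X w in w∈X
    ... | false | _    = refl
    ... | true  | false = ∧-zeroʳ _
    ... | true  | true with ltᵇ w v in w<v
    ...   | true  = refl
    ...   | false = ⊥-elim (true≢false (trans (sym v-visited) unvisited))
      where
      w≢v : w ≢ v
      w≢v refl = true≢false (trans (sym vw) (adj-irr G v))
      v-visited : visited v ≡ true
      v-visited = visited-intro w v w∈X
        (trans (lookup-N⁻[] w v) (cong (_∨ eqᵇ v w) (cong₂ _∧_ (trans (adj-sym G w v) vw) (ltᵇ-connex w v w≢v w<v))))

  finalGain : Fin n × Subset n → ℤ
  finalGain (u , S) = if lookup X u then 0ℤ else δ S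

  outsideGain : Fin n → ℤ
  outsideGain v = if lookup X v then 0ℤ else δ (Nb G v ∩ X)

  final-Tr : ∀ l s → Tr (foldl final-u s l) Z ≡ Tr s Z +ᶻ ∑ₗ finalGain l
  final-Tr = foldl-additive final-u (λ s → Tr s Z) finalGain step
    where
    step : ∀ s e → Tr (final-u s e) Z ≡ Tr s Z +ᶻ finalGain e
    step s (u , S) with lookup X u
    ... | true  = sym (ℤP.+-identityʳ _)
    ... | false = trans (addTr-δ S 1ℤ (Tr s)) (cong (Tr s Z +ᶻ_) (ℤP.*-identityˡ (δ S)))

  finalGain-entry : ∀ e → Entry processed e → finalGain e ≡ outsideGain (proj₁ e)
  finalGain-entry (v , S) entry with lookup X v in v∈X
  ... | true  = refl
  ... | false = cong δ (lookup-ext λ w → trans (entry w) (entry-outside v v∈X w))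

  δ-sym : ∀ A → δ A ≡ (if ⌊ A ≟ₛ Z ⌋ then 1ℤ else 0ℤ)
  δ-sym A = cong (λ b → if b then 1ℤ else 0ℤ) (⌊⌋-⇔ (mk⇔ sym sym) (Z ≟ₛ A) (A ≟ₛ Z))

  counted : Fin n → Bool
  counted y = not (lookup X y) ∧ ⌊ (Nb G y ∩ X) ≟ₛ Z ⌋

  counted-pointwise : ∀ v → δ (N⁻ G v ∩ X) +ᶻ (if visited v then outsideGain v -ᶻ δ (N⁻ G v ∩ X) else 0ℤ)
                            ≡ (if counted v then 1ℤ else 0ℤ)
  counted-pointwise v with lookup X v in v∈X
  ... | true rewrite visited-intro v v v∈X (N⁻[]-self v) =
    cancel (δ (N⁻ G v ∩ X))
    where
    cancel : ∀ d → d +ᶻ (0ℤ -ᶻ d) ≡ 0ℤ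
    cancel = solve-∀
  ... | false with visited v in v-visited
  ...   | true  = trans (cancel (δ (N⁻ G v ∩ X)) (δ (Nb G v ∩ X))) (δ-sym (Nb G v ∩ X))
    where
    cancel : ∀ d a → d +ᶻ (a -ᶻ d) ≡ a
    cancel = solve-∀
  ...   | false = trans (ℤP.+-identityʳ _) (trans (cong δ (N⁻∩X-unvisited v v-visited)) (δ-sym (Nb G v ∩ X)))

  Tr-query : Tr run Z ≡ ℤ.+ trFreq G X Z
  Tr-query = begin
    Tr run Z
      ≡⟨ final-Tr (L s₂) s₂ ⟩
    Tr s₂ Z +ᶻ ∑ₗ finalGain (L s₂)
      ≡⟨ cong (Tr s₂ Z +ᶻ_) (∑ₗ-cong (L s₂) (All.map (λ {e} → finalGain-entry e) entries)) ⟩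
    Tr s₂ Z +ᶻ ∑ₗ (outsideGain ∘ proj₁) (L s₂)
      ≡⟨ rebalance (Tr s₂ Z) (keyWeight (L s₂)) _ (Tr s₁ Z) balance ⟩
    Tr s₁ Z +ᶻ (∑ₗ (outsideGain ∘ proj₁) (L s₂) -ᶻ keyWeight (L s₂))
      ≡⟨ cong (Tr s₁ Z +ᶻ_) (∑ₗ-- (outsideGain ∘ proj₁) (λ e → δ (N⁻ G (proj₁ e) ∩ X)) (L s₂)) ⟩
    Tr s₁ Z +ᶻ ∑ₗ (gain ∘ proj₁) (L s₂)
      ≡⟨ cong₂ _+ᶻ_ Tr-after-step1 (trans (∑ₗ-keys gain (L s₂) distinct)
                                         (sum-cong-≗ λ v → cong (λ b → if b then gain v else 0ℤ) (keys v))) ⟩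
    ∑[ v < n ] δ (N⁻ G v ∩ X) +ᶻ ∑[ v < n ] (if visited v then gain v else 0ℤ)
      ≡⟨ ∑-distrib-+ (λ v → δ (N⁻ G v ∩ X)) (λ v → if visited v then gain v else 0ℤ) ⟨
    ∑[ v < n ] (δ (N⁻ G v ∩ X) +ᶻ (if visited v then gain v else 0ℤ))
      ≡⟨ sum-cong-≗ counted-pointwise ⟩
    ∑[ v < n ] (if counted v then 1ℤ else 0ℤ)
      ≡⟨ ∑-indicator counted ⟨
    ℤ.+ ∣ tabulate counted ∣
      ≡⟨ cong ℤ.+_ (length-filterᵇ-tabulate counted (λ i → i)) ⟨
    ℤ.+ trFreq G X Z ∎
    where
    open ≡-Reasoning
    open Step2Invariant Step2Invariant-s₂
    gain : Fin n → ℤ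
    gain v = outsideGain v -ᶻ δ (N⁻ G v ∩ X)
    rebalance : ∀ t k a T → t +ᶻ k ≡ T → t +ᶻ a ≡ T +ᶻ (a -ᶻ k)
    rebalance t k a _ refl = shift t k a
      where
      shift : ∀ t k a → t +ᶻ a ≡ t +ᶻ k +ᶻ (a -ᶻ k)
      shift = solve-∀

query-correct : (G : Graph n) (X S : Subset n) → Tr (query G (Rinit G) X) S ≡ ℤ.+ trFreq G X S
query-correct G X S = KeyCount.Tr-query G X S

-- Running time

keyCost : ℕ → ℕ
keyCost d = 3 * suc d

step1Cost : ℕ → ℕ → ℕ
step1Cost s d = 1 + binom≤ (suc s) d * keyCost d

pairCost : ℕ → ℕ
pairCost d = (2 + suc d + suc d) + (3 + d)

step2Cost : ℕ → ℕ
step2Cost d = 1 + suc d * pairCost d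

^-+2 : ∀ s d → s ^ (d + 2) ≡ s * (s * s ^ d)
^-+2 s d = trans (ℕP.^-distribˡ-+-* s d 2) (commute (s ^ d) s)
  where
  commute : ∀ P s → P * (s * (s * 1)) ≡ s * (s * P)
  commute = ℕ-solve-∀

s*s≤s^[d+2] : ∀ t d → suc t * suc t ≤ suc t ^ (d + 2)
s*s≤s^[d+2] t d = begin
  s * s              ≡⟨ cong (s *_) (ℕP.*-identityʳ s) ⟨
  s * (s * 1)        ≤⟨ ℕP.*-monoʳ-≤ s (ℕP.*-monoʳ-≤ s (ℕP.m^n>0 s d)) ⟩
  s * (s * s ^ d)    ≡⟨ ^-+2 s d ⟨
  s ^ (d + 2)        ∎
  where
  open ℕP.≤-Reasoning
  s = suc t

step1Cost-bound : ∀ t d → d ≤ suc t → step1Cost (suc t) d ≤ 19 * suc t ^ (d + 2)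
step1Cost-bound t d d≤s = begin
  1 + binom≤ (suc s) d * (3 * suc d)
    ≤⟨ ℕP.+-mono-≤ (ℕP.m^n>0 s (d + 2)) (ℕP.*-mono-≤ (binom≤-bound-small t d d≤s) (ℕP.*-monoʳ-≤ 3 1+d≤2s)) ⟩
  E + 3 * (s * s ^ d) * (3 * (s + s))
    ≡⟨ cong (E +_) (trans (regroup s (s ^ d)) (cong (18 *_) (sym (^-+2 s d)))) ⟩
  E + 18 * E
    ≡⟨ collect E ⟩
  19 * E ∎
  where
  open ℕP.≤-Reasoning
  s = suc t
  E = s ^ (d + 2)
  1+d≤2s : suc d ≤ s + s
  1+d≤2s = ℕP.≤-trans (s≤s d≤s) (s≤s (ℕP.m≤n+m (suc t) t))
  regroup : ∀ s P → 3 * (s * P) * (3 * (s + s)) ≡ 18 * (s * (s * P))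
  regroup = ℕ-solve-∀
  collect : ∀ E → E + 18 * E ≡ 19 * E
  collect = ℕ-solve-∀

step2Cost-mono : ∀ {d d′} → d ≤ d′ → step2Cost d ≤ step2Cost d′
step2Cost-mono d≤d′ =
  s≤s (ℕP.*-mono-≤ (s≤s d≤d′) (ℕP.+-mono-≤ (ℕP.+-mono-≤ (ℕP.+-monoʳ-≤ 2 (s≤s d≤d′)) (s≤s d≤d′)) (ℕP.+-monoʳ-≤ 3 d≤d′)))

step2Cost-bound : ∀ t d → d ≤ suc t → step2Cost d ≤ 21 * suc t ^ (d + 2)
step2Cost-bound t d d≤s = begin
  step2Cost d              ≤⟨ step2Cost-mono d≤s ⟩
  step2Cost (suc t)        ≤⟨ ℕP.m≤m+n (step2Cost (suc t)) (18 * t * t + 26 * t) ⟩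
  step2Cost (suc t) + (18 * t * t + 26 * t) ≡⟨ expand t ⟩
  21 * (suc t * suc t)     ≤⟨ ℕP.*-monoʳ-≤ 21 (s*s≤s^[d+2] t d) ⟩
  21 * suc t ^ (d + 2)     ∎
  where
  open ℕP.≤-Reasoning
  expand : ∀ t → 1 + (1 + (1 + t)) * ((2 + (1 + (1 + t)) + (1 + (1 + t))) + (3 + (1 + t))) + (18 * t * t + 26 * t)
                 ≡ 21 * ((1 + t) * (1 + t))
  expand = ℕ-solve-∀

query-cost-bound : ∀ s d x → 1 ≤ s → d ≤ s →
                   x * step2Cost d + (x * step1Cost s d + 1) ≤ 40 * ((d * d + s ^ (d + 2)) * x) + 40
query-cost-bound (suc t) d x _ d≤s = begin
  x * step2Cost d + (x * step1Cost s d + 1)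
    ≤⟨ ℕP.+-mono-≤ (ℕP.*-monoʳ-≤ x (step2Cost-bound t d d≤s)) (ℕP.+-monoˡ-≤ 1 (ℕP.*-monoʳ-≤ x (step1Cost-bound t d d≤s))) ⟩
  x * (21 * E) + (x * (19 * E) + 1)
    ≡⟨ regroup x E ⟩
  40 * (E * x) + 1
    ≤⟨ ℕP.+-mono-≤ (ℕP.*-monoʳ-≤ 40 (ℕP.*-monoˡ-≤ x (ℕP.m≤n+m E (d * d)))) (s≤s z≤n) ⟩
  40 * ((d * d + E) * x) + 40 ∎
  where
  open ℕP.≤-Reasoning
  s = suc t
  E = s ^ (d + 2)
  regroup : ∀ x E → x * (21 * E) + (x * (19 * E) + 1) ≡ 40 * (E * x) + 1
  regroup = ℕ-solve-∀

module QueryCost (G : Graph n) (X : Subset n) where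
  open QueryRun G X
  open GraphParameters G

  d s : ℕ
  d = dG G
  s = s₂G G

  S²[_] : Fin n → Subset n
  S²[ x ] = tabulate (λ v → lookup (S² G x) v ∨ eqᵇ v x)

  ∣S²[]∣≤ : ∀ x → ∣ S²[ x ] ∣ ≤ suc s
  ∣S²[]∣≤ x = ℕP.≤-trans (∣∣-insert {A = S²[ x ]} {S² G x} x split) (s≤s (∣S²∣≤s₂ x))
    where
    split : ∀ v → lookup S²[ x ] v ≡ true → lookup (S² G x) v ≡ true ⊎ v ≡ x
    split v v∈ with lookup (S² G x) v in v∈S² | eqᵇ v x in v=x | trans (sym (lookup∘tabulate _ v)) v∈
    ... | true  | _    | _ = inj₁ refl
    ... | false | true | _ = inj₂ (eqᵇ⇒≡ v=x)

  key⊆S²[] : ∀ x u → lookup (N⁻ G u) x ≡ true → ∀ v → lookup (N⁻ G u ∩ V≤ x) v ≡ true → lookup S²[ x ] v ≡ true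
  key⊆S²[] x u x∈N⁻u v v∈key = trans (lookup∘tabulate _ v) reach
    where
    v∈key′ : ((adj G u v ∧ ltᵇ v u) ∧ leᵇ v x) ≡ true
    v∈key′ = trans (sym (trans (lookup-∩ (N⁻ G u) (V≤ x) v) (cong₂ _∧_ (lookup-N⁻ u v) (lookup∘tabulate _ v)))) v∈key
    x∈N⁻u′ : (adj G u x ∧ ltᵇ x u) ≡ true
    x∈N⁻u′ = trans (sym (lookup-N⁻ u x)) x∈N⁻u
    reach : (lookup (S² G x) v ∨ eqᵇ v x) ≡ true
    reach with v FinP.≟ x
    ... | yes refl = ∨-zeroʳ _
    ... | no v≢x = trans (cong (_∨ false) (trans (lookup∘tabulate _ v) 2-reach)) (∨-identityʳ true)
      where
      v<x : ltᵇ v x ≡ true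
      v<x = ⌊⌋-true (v FinP.<? x) (FinP.≤∧≢⇒< (⌊⌋-sound (v FinP.≤? x) (∧-conicalʳ _ _ v∈key′)) v≢x)
      via-u : BL.any (λ w → ltᵇ x w ∧ adj G x w ∧ adj G w v) (allFin n) ≡ true
      via-u = any-tabulate (λ w → ltᵇ x w ∧ adj G x w ∧ adj G w v) (λ w → w) u
                (trans (cong₂ (λ a b → a ∧ b ∧ adj G u v) (∧-conicalʳ (adj G u x) _ x∈N⁻u′)
                                                                (trans (adj-sym G x u) (∧-conicalˡ _ (ltᵇ x u) x∈N⁻u′)))
                       (∧-conicalˡ (adj G u v) (ltᵇ v u) (∧-conicalˡ _ (leᵇ v x) v∈key′)))
      2-reach : (ltᵇ v x ∧ (adj G x v ∨ BL.any (λ w → ltᵇ x w ∧ adj G x w ∧ adj G w v) (allFin n))) ≡ true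
      2-reach rewrite v<x | via-u = ∨-zeroʳ _

  ∣key∣≤d : ∀ x u → ∣ N⁻ G u ∩ V≤ x ∣ ≤ d
  ∣key∣≤d x u = ℕP.≤-trans (∣p∩q∣≤∣p∣ (N⁻ G u) (V≤ x)) (∣N⁻∣≤d u)

  Rinit-keys : ∀ x → Unique (keysOf (Rinit G x)) × All (SmallSubsetOf S²[ x ] d) (keysOf (Rinit G x))
  Rinit-keys x = foldl-invariant (λ acc → Unique (keysOf acc) × All (SmallSubsetOf S²[ x ] d) (keysOf acc))
                   _ step (allFin n) [] ([] , [])
    where
    step : ∀ acc u → Unique (keysOf acc) × All (SmallSubsetOf S²[ x ] d) (keysOf acc) →
           let acc′ = if lookup (N⁻ G u) x then incr (N⁻ G u ∩ V≤ x) acc else acc in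
           Unique (keysOf acc′) × All (SmallSubsetOf S²[ x ] d) (keysOf acc′)
    step acc u (unique , small) with lookup (N⁻ G u) x in x∈N⁻u
    ... | true  = Unique-incr _ acc unique
                , All-incr _ acc small (key⊆ , ∣key∣≤d x u)
      where
      key⊆ : (N⁻ G u ∩ V≤ x) ⊆ S²[ x ]
      key⊆ v∈ = lookup⇒∈ (key⊆S²[] x u x∈N⁻u _ (∈⇒lookup v∈))
    ... | false = unique , small

  step1-key-cost : ∀ s′ a → ∣ proj₁ a ∣ ≤ d → cost (step1-key s′ a) ≤ keyCost d + cost s′
  step1-key-cost s′ (A , r) ∣A∣≤d = ℕP.+-monoˡ-≤ (cost s′) (begin
    suc ∣ A ∣ + suc ∣ A ∩ X ∣ + suc ∣ removeMax {n} (A ∩ X) ∣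
      ≤⟨ ℕP.+-mono-≤ (ℕP.+-mono-≤ (s≤s ∣A∣≤d) (s≤s ∣A∩X∣≤d)) (s≤s (ℕP.≤-trans (∣removeMax∣≤ {n} (A ∩ X)) ∣A∩X∣≤d)) ⟩
    suc d + suc d + suc d
      ≡⟨ triple (suc d) ⟩
    keyCost d ∎)
    where
    open ℕP.≤-Reasoning
    ∣A∩X∣≤d = ℕP.≤-trans (∣p∩q∣≤∣p∣ A X) ∣A∣≤d
    triple : ∀ k → k + k + k ≡ 3 * k
    triple = ℕ-solve-∀

  length-Rinit : ∀ x → length (Rinit G x) ≤ binom≤ (suc s) d
  length-Rinit x = begin
    length (Rinit G x)              ≡⟨ length-map proj₁ (Rinit G x) ⟨
    length (keysOf (Rinit G x))     ≤⟨ length-unique-small-subsets S²[ x ] d _ (proj₁ (Rinit-keys x)) (proj₂ (Rinit-keys x)) ⟩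
    binom≤ ∣ S²[ x ] ∣ d           ≤⟨ binom≤-monoˡ d (∣S²[]∣≤ x) ⟩
    binom≤ (suc s) d                ∎
    where open ℕP.≤-Reasoning

  step1-cost : ∀ s′ x → cost (step1 s′ x) ≤ step1Cost s d + cost s′
  step1-cost s′ x = begin
    cost (step1 s′ x)
      ≤⟨ foldl-bounded step1-key cost (λ a → ∣ proj₁ a ∣ ≤ d) (keyCost d) step1-key-cost
                       (Rinit G x) (tick 1 s′) (All.map proj₂ (map⁻ (proj₂ (Rinit-keys x)))) ⟩
    length (Rinit G x) * keyCost d + suc (cost s′)
      ≤⟨ ℕP.+-monoˡ-≤ (suc (cost s′)) (ℕP.*-monoˡ-≤ (keyCost d) (length-Rinit x)) ⟩
    binom≤ (suc s) d * keyCost d + suc (cost s′)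
      ≡⟨ ℕP.+-suc _ (cost s′) ⟩
    step1Cost s d + cost s′ ∎
    where open ℕP.≤-Reasoning

  length-xs : length xs ≡ ∣ X ∣
  length-xs = length-elems X

  cost-s₁ : cost s₁ ≤ ∣ X ∣ * step1Cost s d + 1
  cost-s₁ = ℕP.≤-trans (foldl-bounded step1 cost (λ _ → ⊤) (step1Cost s d) (λ s′ x _ → step1-cost s′ x)
                                      xs init (All.universal _ xs))
                       (ℕP.≤-reflexive (cong (λ k → k * step1Cost s d + 1) length-xs))

  -- Step (2) is amortised: each new key of L prepays the cost of its final iteration.
  Φ : State {n} → ℕ
  Φ s′ = cost s′ + weight (L s′)

  step2-u-Φ : ∀ x u s′ → Φ (step2-u x s′ u) ≤ pairCost d + Φ s′
  step2-u-Φ x u s′ with L-find u (L s′) in u∈L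
  ... | true = begin
    2 + cost s′ + weight (L-addTo u x (L s′))
      ≤⟨ ℕP.+-monoʳ-≤ (2 + cost s′) (weight-addTo u x (L s′)) ⟩
    2 + cost s′ + (1 + weight (L s′))
      ≡⟨ regroup (cost s′) (weight (L s′)) ⟩
    3 + Φ s′
      ≤⟨ ℕP.+-monoˡ-≤ (Φ s′) (ℕP.≤-trans (ℕP.m≤m+n 3 d) (ℕP.m≤n+m (3 + d) (2 + suc d + suc d))) ⟩
    pairCost d + Φ s′ ∎
    where
    open ℕP.≤-Reasoning
    regroup : ∀ c w → 2 + c + (1 + w) ≡ 3 + (c + w)
    regroup = ℕ-solve-∀
  ... | false = begin
    2 + suc ∣ N⁻ G u ∣ + suc ∣ S ∣ + cost s′ + weight (L-addTo u x (L s′ ++ (u , S) ∷ []))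
      ≤⟨ ℕP.+-mono-≤ (ℕP.+-monoˡ-≤ (cost s′) (ℕP.+-mono-≤ (ℕP.+-monoʳ-≤ 2 (s≤s (∣N⁻∣≤d u))) (s≤s ∣S∣≤d)))
                     (weight-addTo u x (L s′ ++ (u , S) ∷ [])) ⟩
    2 + suc d + suc d + cost s′ + (1 + weight (L s′ ++ (u , S) ∷ []))
      ≡⟨ cong (λ w → 2 + suc d + suc d + cost s′ + (1 + w)) (weight-++ (L s′) _) ⟩
    2 + suc d + suc d + cost s′ + (1 + (weight (L s′) + (2 + ∣ S ∣ + 0)))
      ≤⟨ ℕP.+-monoʳ-≤ (2 + suc d + suc d + cost s′) (s≤s (ℕP.+-monoʳ-≤ (weight (L s′)) (ℕP.+-monoˡ-≤ 0 (ℕP.+-monoʳ-≤ 2 ∣S∣≤d)))) ⟩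
    2 + suc d + suc d + cost s′ + (1 + (weight (L s′) + (2 + d + 0)))
      ≡⟨ regroup d (cost s′) (weight (L s′)) ⟩
    pairCost d + Φ s′ ∎
    where
    open ℕP.≤-Reasoning
    S = N⁻ G u ∩ X
    ∣S∣≤d = ℕP.≤-trans (∣p∩q∣≤∣p∣ (N⁻ G u) X) (∣N⁻∣≤d u)
    regroup : ∀ d c w → 2 + suc d + suc d + c + (1 + (w + (2 + d + 0))) ≡ (2 + suc d + suc d) + (3 + d) + (c + w)
    regroup = ℕ-solve-∀

  ∣N⁻[]∣≤ : ∀ x → length (elems (N⁻[ G ] x)) ≤ suc d
  ∣N⁻[]∣≤ x = begin
    length (elems (N⁻[ G ] x))   ≡⟨ length-elems (N⁻[ G ] x) ⟩
    ∣ N⁻[ G ] x ∣                 ≤⟨ ∣∣-insert {A = N⁻[ G ] x} {N⁻ G x} x split ⟩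
    suc ∣ N⁻ G x ∣                ≤⟨ s≤s (∣N⁻∣≤d x) ⟩
    suc d                        ∎
    where
    open ℕP.≤-Reasoning
    split : ∀ v → lookup (N⁻[ G ] x) v ≡ true → lookup (N⁻ G x) v ≡ true ⊎ v ≡ x
    split v v∈ with (adj G x v ∧ ltᵇ v x) in v∈N⁻ | eqᵇ v x in v=x | trans (sym (lookup-N⁻[] x v)) v∈
    ... | true  | _    | _ = inj₁ (trans (lookup-N⁻ x v) v∈N⁻)
    ... | false | true | _ = inj₂ (eqᵇ⇒≡ v=x)

  step2-Φ : ∀ s′ x → Φ (step2 s′ x) ≤ step2Cost d + Φ s′
  step2-Φ s′ x = begin
    Φ (step2 s′ x)
      ≤⟨ foldl-bounded (step2-u x) Φ (λ _ → ⊤) (pairCost d) (λ s u _ → step2-u-Φ x u s)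
                       (elems (N⁻[ G ] x)) (tick 1 s′) (All.universal _ _) ⟩
    length (elems (N⁻[ G ] x)) * pairCost d + suc (Φ s′)
      ≤⟨ ℕP.+-monoˡ-≤ (suc (Φ s′)) (ℕP.*-monoˡ-≤ (pairCost d) (∣N⁻[]∣≤ x)) ⟩
    suc d * pairCost d + suc (Φ s′)
      ≡⟨ ℕP.+-suc _ (Φ s′) ⟩
    step2Cost d + Φ s′ ∎
    where open ℕP.≤-Reasoning

  final-cost : ∀ l s′ → cost (foldl final-u s′ l) ≤ weight l + cost s′
  final-cost [] s′ = ℕP.≤-refl
  final-cost ((u , S) ∷ l) s′ = begin
    cost (foldl final-u (final-u s′ (u , S)) l)   ≤⟨ final-cost l (final-u s′ (u , S)) ⟩
    weight l + cost (final-u s′ (u , S))          ≤⟨ ℕP.+-monoʳ-≤ (weight l) entry-cost ⟩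
    weight l + ((2 + ∣ S ∣) + cost s′)            ≡⟨ regroup (weight l) (2 + ∣ S ∣) (cost s′) ⟩
    weight ((u , S) ∷ l) + cost s′                ∎
    where
    open ℕP.≤-Reasoning
    entry-cost : cost (final-u s′ (u , S)) ≤ (2 + ∣ S ∣) + cost s′
    entry-cost with lookup X u
    ... | true  = s≤s (ℕP.m≤n+m (cost s′) (suc ∣ S ∣))
    ... | false = ℕP.≤-refl
    regroup : ∀ a b c → a + (b + c) ≡ b + a + c
    regroup = ℕ-solve-∀

  cost-run : cost run ≤ ∣ X ∣ * step2Cost d + (∣ X ∣ * step1Cost s d + 1)
  cost-run = begin
    cost run
      ≤⟨ final-cost (L s₂) s₂ ⟩
    weight (L s₂) + cost s₂
      ≡⟨ ℕP.+-comm (weight (L s₂)) (cost s₂) ⟩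
    Φ s₂
      ≤⟨ foldl-bounded step2 Φ (λ _ → ⊤) (step2Cost d) (λ s′ x _ → step2-Φ s′ x) xs s₁ (All.universal _ xs) ⟩
    length xs * step2Cost d + Φ s₁
      ≡⟨ cong₂ (λ k L₀ → k * step2Cost d + (cost s₁ + weight L₀)) length-xs L-s₁ ⟩
    ∣ X ∣ * step2Cost d + (cost s₁ + 0)
      ≤⟨ ℕP.+-monoʳ-≤ (∣ X ∣ * step2Cost d) (ℕP.≤-trans (ℕP.≤-reflexive (ℕP.+-identityʳ _)) cost-s₁) ⟩
    ∣ X ∣ * step2Cost d + (∣ X ∣ * step1Cost s d + 1) ∎
    where
    open ℕP.≤-Reasoning

query-cost : (G : Graph n) (X : Subset n) → HasEdge G →
             cost (query G (Rinit G) X) ≤ 40 * ((dG G * dG G + s₂G G ^ (dG G + 2)) * ∣ X ∣) + 40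
query-cost G X hasEdge = ℕP.≤-trans (QueryCost.cost-run G X)
  (query-cost-bound (s₂G G) (dG G) ∣ X ∣ (GraphParameters.s₂-positive G hasEdge) (GraphParameters.d≤s₂ G))

open import Data.Integer using (+_)

lemma4 : Σ ℕ λ c → ∀ n (G : Graph n) → HasEdge G → (X : Subset n) →
    ((S : Subset n) → Tr (query G (Rinit G) X) S ≡ + trFreq G X S)
    × (cost (query G (Rinit G) X) ≤ c * ((dG G * dG G + s₂G G ^ (dG G + 2)) * ∣ X ∣) + c)
lemma4 = 40 , λ n G hasEdge X → query-correct G X , query-cost G X hasEdge
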